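{- Let $n\geq 5$ and let $f:\{0,1\}^n\to\{0,1\}^n$ be a non-constant Boolean network. If $f$ has an independent set of size at least $2n$, then $K_n\in\mathcal{G}(f)$.
   Context: A Boolean network with $n$ components is a map $f:\{0,1\}^n\to\{0,1\}^n$, $x\mapsto(f_1(x),\dots,f_n(x))$. An independent set of $f$ is a set $A\subseteq\{0,1\}^n$ with $f(A)\cap A=\emptyset$. For $i\in[n]$, $e_i$ is the configuration with a $1$ exactly in component $i$, and $x+y$ is componentwise addition modulo 2. The interaction graph $G(f)$ has vertex set $[n]$ and an arc from $j$ to $i$ (loops allowed) iff there is $x$ with $f_i(x)\neq f_i(x+e_j)$. Networks $f,h$ are isomorphic if $h\circ\pi=\pi\circ f$ for some permutation $\pi$ of $\{0,1\}^n$; $\mathcal{G}(f)$ is the set of $G(h)$ for all $h$ isomorphic to $f$. $K_n$ is the complete digraph on $[n]$ with all $n^2$ arcs (including loops). -}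

module Defs where

open import Data.Bool using (Bool; true; false; not)
open import Data.Nat using (ℕ; _≤_; _*_)
open import Data.Fin using (Fin)
open import Data.Vec using (Vec; lookup; updateAt)
open import Data.List using (List; length)
open import Data.List.Membership.Propositional using (_∈_; _∉_)
open import Data.List.Relation.Unary.Unique.Propositional using (Unique)
open import Data.Product using (Σ; ∃; _×_; _,_)
open import Function using (_∘_)
open import Function.Bundles using (_↔_; Inverse)
open import Relation.Binary.PropositionalEquality using (_≡_; _≢_)

Config : ℕ → Set
Config n = Vec Bool n

BN : ℕ → Set
BN n = Config n → Config n

flipAt : ∀ {n} → Fin n → Config n → Config n
flipAt i x = updateAt x i not

comp : ∀ {n} → BN n → Fin n → Config n → Bool
comp f i x = lookup (f x) i

NonConstant : ∀ {n} → BN n → Set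
NonConstant {n} f = Σ (Config n) λ x → Σ (Config n) λ y → f x ≢ f y

IsIndependent : ∀ {n} → BN n → List (Config n) → Set
IsIndependent f A = Unique A × (∀ x → x ∈ A → f x ∉ A)

HasIndepSetOfSize≥ : ∀ {n} → BN n → ℕ → Set
HasIndepSetOfSize≥ {n} f k =
  Σ (List (Config n)) λ A → IsIndependent f A × (k ≤ length A)

Arc : ∀ {n} → BN n → Fin n → Fin n → Set
Arc {n} f j i = Σ (Config n) λ x → comp f i x ≢ comp f i (flipAt j x)

-- G(f) = K_n : every arc (including loops) is present
IsComplete : ∀ {n} → BN n → Set
IsComplete f = ∀ j i → Arc f j i

IsomorphicVia : ∀ {n} → BN n → BN n → (Config n ↔ Config n) → Set
IsomorphicVia {n} f h π = ∀ x → h (Inverse.to π x) ≡ Inverse.to π (f x)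

CompleteInIsoClass : ∀ {n} → BN n → Set
CompleteInIsoClass {n} f =
  Σ (BN n) λ h → Σ (Config n ↔ Config n) λ π → IsomorphicVia f h π × IsComplete h

module Submission where

-- Conjugating f by a permutation π gives h = π ∘ f ∘ π⁻¹.  If in every direction j some edge {π x₁ , π x₂}
-- of the cube has complementary images π (f x₁), π (f x₂), then every component of h changes along it and
-- G(h) = K_n.  Such a π is obtained by prescribing the images ("labels") of finitely many points and
-- completing by transpositions.
-- Take 2n points of the independent set A; no image of a point of A lies in A.  If all of them have the same
-- image c, a star centred at some z with f z ≠ c uses every direction.  Otherwise group the points by their
-- images and pair up the classes, dropping the smallest one if their number is odd.  A pair of classes with
-- images c, d and s points in total is laid out as a caterpillar whose s − 1 edges join c-points to d-points
-- in consecutive directions, and c, d get complementary labels that are used nowhere else (there are enough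
-- of them as 3n ≤ 2^(n−1)).  The coverage adds up to at least n directions; caterpillars on disjoint blocks
-- of directions have distinct labels thanks to a tag coordinate.

open import Defs
open import Data.Bool using (Bool; true; false; not; _xor_)
open import Data.Bool.Properties using (xor-assoc; xor-comm; true-xor; xor-identityʳ; not-involutive) renaming (_≟_ to _≟ᵇ_)
open import Data.Empty using (⊥; ⊥-elim)
open import Data.Fin using (Fin; toℕ)
open import Data.Fin.Properties using (toℕ-injective; toℕ<n; toℕ-fromℕ<)
import Data.Fin as Fin
open import Data.List using (List; []; _∷_; length; map; filter; take; concatMap; _++_)
open import Data.List.Properties using (length-++; length-map; length-take; length-filter; concatMap-map; concatMap-cong; map-concatMap; map-++)
open import Data.List.Relation.Binary.Disjoint.Propositional using (Disjoint)
open import Data.List.Relation.Binary.Sublist.Propositional using (_⊆_; []; _∷_; _∷ʳ_; minimum; ⊆-reflexive; ⊆-refl)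
import Data.List.Relation.Binary.Sublist.Propositional.Properties as Sublist
open import Data.List.Relation.Binary.Sublist.Propositional.Properties using (All-resp-⊆)
open import Data.List.Membership.Propositional using (_∈_; _∉_; find)
open import Data.List.Membership.Propositional.Properties using (∈-map⁺; ∈-map⁻; ∈-filter⁺; ∈-filter⁻; ∈-concatMap⁻; ∈-concat⁺′; ∈-++⁺ˡ; ∈-++⁺ʳ; ∈-++⁻)
open import Data.List.Membership.DecPropositional using () renaming (_∈?_ to member?)
open import Data.List.Relation.Unary.All as All using (All; []; _∷_)
import Data.List.Relation.Unary.All.Properties as All
open import Data.List.Relation.Unary.AllPairs as AllPairs using (AllPairs; []; _∷_)
import Data.List.Relation.Unary.AllPairs.Properties as AllPairs
open import Data.List.Relation.Unary.Any using (here; there)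
open import Data.List.Extrema.Nat using (argmin; argmin-sel; f[argmin]≤f[⊤]; f[argmin]≤f[xs])
open import Data.List.Relation.Unary.Unique.Propositional using (Unique)
import Data.List.Relation.Unary.Unique.Propositional.Properties as Unique
open import Data.Nat using (ℕ; zero; suc; _+_; _*_; _∸_; _^_; _≤_; _<_; _≟_; _≤?_; _<?_; z≤n; s≤s)
open import Data.Nat.Properties
open import Data.Nat.Solver using (module +-*-Solver)
open import Data.Product using (Σ; _×_; _,_; proj₁; proj₂)
open import Data.Sum using (_⊎_; inj₁; inj₂)
import Data.Sum
open import Data.Vec using (Vec; lookup; tabulate)
import Data.Vec as Vec
open import Data.Vec.Properties using (lookup∘tabulate; tabulate∘lookup; tabulate-cong; tabulate-∘; lookup∘updateAt; lookup∘updateAt′; lookup-map; ≡-dec; map-∘; map-cong; map-id)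
open import Function using (_∘_; id; const)
open import Level using (0ℓ)
open import Function.Bundles using (_↔_; Inverse; mk↔ₛ′)
open import Function.Construct.Composition using (_↔-∘_)
open import Function.Construct.Identity using (↔-id)
open import Relation.Binary using (DecidableEquality)
open import Relation.Binary.PropositionalEquality
open import Relation.Nullary using (yes; no; does)
open import Relation.Nullary.Decidable using (dec-true; dec-false; ¬?; _×-dec_; from-yes)
open import Relation.Unary using (Pred) renaming (Decidable to Decidable₁)
open import Relation.Unary.Properties using (∁?)

module _ {A : Set} where

  remove : (ys : List A) {x : A} → x ∈ ys → List A
  remove (y ∷ ys) (here _) = ys
  remove (y ∷ ys) (there p) = y ∷ remove ys p

  length-remove : (ys : List A) {x : A} (p : x ∈ ys) → suc (length (remove ys p)) ≡ length ys
  length-remove (y ∷ ys) (here _) = refl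
  length-remove (y ∷ ys) (there p) = cong suc (length-remove ys p)

  ∈-remove : (ys : List A) {x z : A} (p : x ∈ ys) → z ∈ ys → z ≢ x → z ∈ remove ys p
  ∈-remove (y ∷ ys) (here refl) (here refl) z≢x = ⊥-elim (z≢x refl)
  ∈-remove (y ∷ ys) (here refl) (there q) _ = q
  ∈-remove (y ∷ ys) (there p) (here z≡y) _ = here z≡y
  ∈-remove (y ∷ ys) (there p) (there q) z≢x = there (∈-remove ys p q z≢x)

  unique-length-≤ : {xs ys : List A} → Unique xs → (∀ {z} → z ∈ xs → z ∈ ys) → length xs ≤ length ys
  unique-length-≤ {[]} _ _ = z≤n
  unique-length-≤ {x ∷ xs} {ys} (x∉xs ∷ xs!) xs⊆ys =
    subst (_ ≤_) (length-remove ys x∈ys) (s≤s (unique-length-≤ xs! xs⊆ys-x))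
    where
    x∈ys : x ∈ ys
    x∈ys = xs⊆ys (here refl)
    xs⊆ys-x : ∀ {z} → z ∈ xs → z ∈ remove ys x∈ys
    xs⊆ys-x z∈xs = ∈-remove ys x∈ys (xs⊆ys (there z∈xs)) (λ z≡x → All.lookup x∉xs z∈xs (sym z≡x))

  length-take-≤ : ∀ {k} {xs : List A} → k ≤ length xs → length (take k xs) ≡ k
  length-take-≤ {k} {xs} k≤ = trans (length-take k xs) (m≤n⇒m⊓n≡m k≤)

  remove-⊆ : (ys : List A) {x : A} (p : x ∈ ys) → remove ys p ⊆ ys
  remove-⊆ (y ∷ ys) (here _) = y ∷ʳ ⊆-refl
  remove-⊆ (y ∷ ys) (there p) = refl ∷ remove-⊆ ys p

  ∈-take⁻ : ∀ k (xs : List A) {x} → x ∈ take k xs → x ∈ xs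
  ∈-take⁻ k xs = Sublist.Any-resp-⊆ (Sublist.take-⊆ k xs)

  length-filter-∁ : {P : Pred A 0ℓ} (P? : Decidable₁ P) (xs : List A) →
                    length (filter P? xs) + length (filter (∁? P?) xs) ≡ length xs
  length-filter-∁ P? [] = refl
  length-filter-∁ P? (x ∷ xs) with P? x
  ... | yes _ = cong suc (length-filter-∁ P? xs)
  ... | no _ = trans (+-suc _ _) (cong suc (length-filter-∁ P? xs))

module _ {A : Set} {R : A → A → Set} where
  allPairs-⊆ : {xs ys : List A} → xs ⊆ ys → AllPairs R ys → AllPairs R xs
  allPairs-⊆ [] [] = []
  allPairs-⊆ (_ ∷ʳ xs⊆ys) (_ ∷ ys!) = allPairs-⊆ xs⊆ys ys!
  allPairs-⊆ (refl ∷ xs⊆ys) (y∉ys ∷ ys!) = All-resp-⊆ xs⊆ys y∉ys ∷ allPairs-⊆ xs⊆ys ys!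

unique-⊆ : ∀ {A : Set} {xs ys : List A} → xs ⊆ ys → Unique ys → Unique xs
unique-⊆ = allPairs-⊆

module _ {X Y : Set} where
  unique-map-++ : (g : X → Y) (S T : List X) → Unique (map g S) → Unique (map g T) →
                  Disjoint (map g S) (map g T) → Unique (map g (S ++ T))
  unique-map-++ g S T S! T! S#T = subst Unique (sym (map-++ g S T)) (Unique.++⁺ S! T! S#T)

Bits : Set
Bits = ℕ → Bool

bit : ℕ → Bits
bit c i = does (i ≟ c)

_⊕_ : Bits → Bits → Bits
(g ⊕ h) i = g i xor h i
infixl 6 _⊕_

fromBits : ∀ {n} → Bits → Config n
fromBits g = tabulate (g ∘ toℕ)

_≟ᶜ_ : ∀ {n} → DecidableEquality (Config n)
_≟ᶜ_ = ≡-dec _≟ᵇ_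

bit-self : ∀ c → bit c c ≡ true
bit-self c = dec-true (c ≟ c) refl

bit-other : ∀ {c i} → i ≢ c → bit c i ≡ false
bit-other {c} {i} = dec-false (i ≟ c)

xor-true : ∀ a → a xor true ≡ not a
xor-true a = trans (xor-comm a true) (true-xor a)

⊕-bit-self : ∀ (g : Bits) c → (g ⊕ bit c) c ≡ not (g c)
⊕-bit-self g c = trans (cong (g c xor_) (bit-self c)) (xor-true (g c))

⊕-bit-other : ∀ (g : Bits) {c i} → i ≢ c → (g ⊕ bit c) i ≡ g i
⊕-bit-other g {c} {i} i≢c = trans (cong (g i xor_) (bit-other i≢c)) (xor-identityʳ (g i))

not-≢ : ∀ a → not a ≢ a
not-≢ false ()
not-≢ true ()

lookup-fromBits : ∀ {n} (g : Bits) (i : Fin n) → lookup (fromBits g) i ≡ g (toℕ i)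
lookup-fromBits g = lookup∘tabulate (g ∘ toℕ)

lookup-ext : ∀ {n} {u v : Config n} → (∀ i → lookup u i ≡ lookup v i) → u ≡ v
lookup-ext {u = u} {v} p = trans (sym (tabulate∘lookup u)) (trans (tabulate-cong p) (tabulate∘lookup v))

fromBits-injectiveAt : ∀ {n} {g h : Bits} → fromBits {n} g ≡ fromBits h → ∀ {c} → c < n → g c ≡ h c
fromBits-injectiveAt {g = g} {h} eq {c} c<n = begin
  g c                    ≡⟨ cong g (toℕ-fromℕ< c<n) ⟨
  g (toℕ i)              ≡⟨ lookup-fromBits g i ⟨
  lookup (fromBits g) i  ≡⟨ cong (λ v → lookup v i) eq ⟩
  lookup (fromBits h) i  ≡⟨ lookup-fromBits h i ⟩
  h (toℕ i)              ≡⟨ cong h (toℕ-fromℕ< c<n) ⟩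
  h c                    ∎
  where
  open ≡-Reasoning
  i : Fin _
  i = Fin.fromℕ< c<n

fromBits-≢ : ∀ {n} (g h : Bits) {c} → c < n → g c ≢ h c → fromBits {n} g ≢ fromBits h
fromBits-≢ g h c<n gc≢hc eq = gc≢hc (fromBits-injectiveAt eq c<n)

flipAt-fromBits : ∀ {n} (j : Fin n) (g : Bits) → flipAt j (fromBits {n} g) ≡ fromBits (g ⊕ bit (toℕ j))
flipAt-fromBits j g = lookup-ext λ i → trans (lookup-flipAt i) (sym (lookup-fromBits (g ⊕ bit (toℕ j)) i))
  where
  lookup-flipAt : ∀ i → lookup (flipAt j (fromBits g)) i ≡ (g ⊕ bit (toℕ j)) (toℕ i)
  lookup-flipAt i with i Fin.≟ j
  ... | yes refl = trans (lookup∘updateAt i (fromBits g))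
                         (trans (cong not (lookup-fromBits g i)) (sym (⊕-bit-self g (toℕ i))))
  ... | no i≢j = trans (lookup∘updateAt′ i j i≢j (fromBits g))
                       (trans (lookup-fromBits g i) (sym (⊕-bit-other g (i≢j ∘ toℕ-injective))))

map-not-fromBits : ∀ {n} (g : Bits) → Vec.map not (fromBits {n} g) ≡ fromBits (not ∘ g)
map-not-fromBits g = sym (tabulate-∘ not (g ∘ toℕ))

⊕-assoc : ∀ (a b c : Bits) i → ((a ⊕ b) ⊕ c) i ≡ (a ⊕ (b ⊕ c)) i
⊕-assoc a b c i = xor-assoc (a i) (b i) (c i)

fromBits-≗ : ∀ {n} {g h : Bits} → (∀ c → g c ≡ h c) → fromBits {n} g ≡ fromBits h
fromBits-≗ g≗h = tabulate-cong (g≗h ∘ toℕ)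

fromBits-≢-not : ∀ {n} (g h : Bits) {c} → c < n → h c ≡ not (g c) → fromBits {n} g ≢ fromBits h
fromBits-≢-not g h c<n hc≡¬gc = fromBits-≢ g h c<n λ gc≡hc → not-≢ (g _) (sym (trans gc≡hc hc≡¬gc))

⊕-bit-injective : ∀ {n} (b : Bits) {c c′} → c < n → c ≢ c′ → fromBits {n} (b ⊕ bit c) ≢ fromBits (b ⊕ bit c′)
⊕-bit-injective b {c} {c′} c<n c≢c′ = fromBits-≢ (b ⊕ bit c) (b ⊕ bit c′) c<n λ eq →
  not-≢ (b c) (trans (sym (⊕-bit-self b c)) (trans eq (⊕-bit-other b c≢c′)))

⊕-false : ∀ (a g : Bits) {c} → g c ≡ false → (a ⊕ g) c ≡ a c
⊕-false a g {c} gc≡false = trans (cong (a c xor_) gc≡false) (xor-identityʳ (a c))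

bit-other-⊕ : ∀ t (g : Bits) {c} → c ≢ t → (bit t ⊕ g) c ≡ g c
bit-other-⊕ t g {c} c≢t = cong (_xor g c) (bit-other c≢t)

-- Permutations extending a partial injection

module _ {A : Set} (_≟ₐ_ : DecidableEquality A) where

  transpose : A → A → A → A
  transpose a b x with x ≟ₐ a
  ... | yes _ = b
  ... | no _ with x ≟ₐ b
  ...   | yes _ = a
  ...   | no _ = x

  transpose-left : ∀ a b → transpose a b a ≡ b
  transpose-left a b with a ≟ₐ a
  ... | yes _ = refl
  ... | no a≢a = ⊥-elim (a≢a refl)

  transpose-right : ∀ a b → transpose a b b ≡ a
  transpose-right a b with b ≟ₐ a
  ... | yes b≡a = b≡a
  ... | no _ with b ≟ₐ b
  ...   | yes _ = refl
  ...   | no b≢b = ⊥-elim (b≢b refl)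

  transpose-fixes : ∀ {a b x} → x ≢ a → x ≢ b → transpose a b x ≡ x
  transpose-fixes {a} {b} {x} x≢a x≢b with x ≟ₐ a
  ... | yes x≡a = ⊥-elim (x≢a x≡a)
  ... | no _ with x ≟ₐ b
  ...   | yes x≡b = ⊥-elim (x≢b x≡b)
  ...   | no _ = refl

  transpose-involutive : ∀ a b x → transpose a b (transpose a b x) ≡ x
  transpose-involutive a b x with x ≟ₐ a
  ... | yes refl = transpose-right x b
  ... | no x≢a with x ≟ₐ b
  ...   | yes refl = transpose-left a x
  ...   | no x≢b = transpose-fixes x≢a x≢b

  transposition : A → A → A ↔ A
  transposition a b = mk↔ₛ′ (transpose a b) (transpose a b) (transpose-involutive a b) (transpose-involutive a b)

  permutation : List (A × A) → A ↔ A
  permutation [] = ↔-id A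
  permutation ((x , y) ∷ ps) = transposition (Inverse.to π x) y ↔-∘ π
    where π = permutation ps

  permutation-extends : ∀ ps → Unique (map proj₁ ps) → Unique (map proj₂ ps) →
                        ∀ {x y} → (x , y) ∈ ps → Inverse.to (permutation ps) x ≡ y
  permutation-extends ((x , y) ∷ ps) _ _ (here refl) = transpose-left (Inverse.to (permutation ps) x) y
  permutation-extends ((x , y) ∷ ps) (x∉xs ∷ xs!) (y∉ys ∷ ys!) {x′} {y′} (there x′↦y′) =
    trans (cong (transpose (to x) y) πx′≡y′) (transpose-fixes y′≢πx y′≢y)
    where
    open Inverse (permutation ps)
    πx′≡y′ : to x′ ≡ y′
    πx′≡y′ = permutation-extends ps xs! ys! x′↦y′
    y′≢y : y′ ≢ y
    y′≢y y′≡y = All.lookup y∉ys (∈-map⁺ proj₂ x′↦y′) (sym y′≡y)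
    y′≢πx : y′ ≢ to x
    y′≢πx y′≡πx = All.lookup x∉xs (∈-map⁺ proj₁ x′↦y′) (sym x′≡x)
      where
      x′≡x : x′ ≡ x
      x′≡x = trans (sym (strictlyInverseʳ x′)) (trans (cong from (trans πx′≡y′ y′≡πx)) (strictlyInverseʳ x))

module _ {n : ℕ} where

  Complementary : Config n → Config n → Set
  Complementary u v = ∀ i → lookup u i ≢ lookup v i

  complementary-sym : ∀ {u v} → Complementary u v → Complementary v u
  complementary-sym u#v i = u#v i ∘ sym

  map-not-complementary : ∀ v → Complementary (Vec.map not v) v
  map-not-complementary v i eq = not-≢ (lookup v i) (trans (sym (lookup-map i not v)) eq)

  record ComplementaryEdge (f : BN n) (π : Config n ↔ Config n) (j : Fin n) : Set where
    open Inverse π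
    field
      x₁ x₂ : Config n
      adjacent : flipAt j (to x₁) ≡ to x₂
      complementary : Complementary (to (f x₁)) (to (f x₂))

  conjugate-complete : (f : BN n) (π : Config n ↔ Config n) →
                       (∀ j → ComplementaryEdge f π j) → CompleteInIsoClass f
  conjugate-complete f π edge = h , π , h∘π≡π∘f , complete
    where
    open Inverse π
    h : BN n
    h = to ∘ f ∘ from
    h∘π≡π∘f : IsomorphicVia f h π
    h∘π≡π∘f x = cong (to ∘ f) (strictlyInverseʳ x)
    complete : IsComplete h
    complete j i = to x₁ , λ eq → complementary i (begin
      lookup (to (f x₁)) i          ≡⟨ image-at x₁ ⟨
      comp h i (to x₁)              ≡⟨ eq ⟩
      comp h i (flipAt j (to x₁))   ≡⟨ cong (comp h i) adjacent ⟩
      comp h i (to x₂)              ≡⟨ image-at x₂ ⟩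
      lookup (to (f x₂)) i          ∎)
      where
      open ComplementaryEdge (edge j)
      open ≡-Reasoning
      image-at : ∀ x → comp h i (to x) ≡ lookup (to (f x)) i
      image-at x = cong (λ v → lookup v i) (h∘π≡π∘f x)

  -- ps lists pairs (point , label); the permutation sends every point to its label.
  record LabelledEdge (f : BN n) (ps : List (Config n × Config n)) (j : Fin n) : Set where
    field
      x₁ x₂ y ℓ₁ ℓ₂ : Config n
      x₁↦y : (x₁ , y) ∈ ps
      x₂↦flipped-y : (x₂ , flipAt j y) ∈ ps
      fx₁↦ℓ₁ : (f x₁ , ℓ₁) ∈ ps
      fx₂↦ℓ₂ : (f x₂ , ℓ₂) ∈ ps
      ℓ₁#ℓ₂ : Complementary ℓ₁ ℓ₂

  labelling-complete : (f : BN n) (ps : List (Config n × Config n)) →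
                       Unique (map proj₁ ps) → Unique (map proj₂ ps) →
                       (∀ j → LabelledEdge f ps j) → CompleteInIsoClass f
  labelling-complete f ps points! labels! edge = conjugate-complete f π complementaryEdge
    where
    π : Config n ↔ Config n
    π = permutation _≟ᶜ_ ps
    π-extends : ∀ {x y} → (x , y) ∈ ps → Inverse.to π x ≡ y
    π-extends = permutation-extends _≟ᶜ_ ps points! labels!
    complementaryEdge : ∀ j → ComplementaryEdge f π j
    complementaryEdge j = record
      { x₁ = x₁ ; x₂ = x₂
      ; adjacent = trans (cong (flipAt j) (π-extends x₁↦y)) (sym (π-extends x₂↦flipped-y))
      ; complementary = subst₂ Complementary (sym (π-extends fx₁↦ℓ₁)) (sym (π-extends fx₂↦ℓ₂)) ℓ₁#ℓ₂ }
      where open LabelledEdge (edge j)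

allVec : (m : ℕ) → List (Vec Bool m)
allVec zero = Vec.[] ∷ []
allVec (suc m) = map (false Vec.∷_) (allVec m) ++ map (true Vec.∷_) (allVec m)

length-allVec : ∀ m → length (allVec m) ≡ 2 ^ m
length-allVec zero = refl
length-allVec (suc m) = begin
  length (map (false Vec.∷_) (allVec m) ++ map (true Vec.∷_) (allVec m))
    ≡⟨ length-++ (map (false Vec.∷_) (allVec m)) ⟩
  length (map (false Vec.∷_) (allVec m)) + length (map (true Vec.∷_) (allVec m))
    ≡⟨ cong₂ _+_ (length-map _ (allVec m)) (length-map _ (allVec m)) ⟩
  length (allVec m) + length (allVec m)
    ≡⟨ cong₂ _+_ (length-allVec m) (trans (length-allVec m) (sym (+-identityʳ (2 ^ m)))) ⟩
  2 ^ suc m ∎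
  where open ≡-Reasoning

∷-injectiveʳ : ∀ {m} {a b : Bool} {u v : Vec Bool m} → a Vec.∷ u ≡ b Vec.∷ v → u ≡ v
∷-injectiveʳ refl = refl

allVec-unique : ∀ m → Unique (allVec m)
allVec-unique zero = [] ∷ []
allVec-unique (suc m) =
  Unique.++⁺ (Unique.map⁺ ∷-injectiveʳ (allVec-unique m)) (Unique.map⁺ ∷-injectiveʳ (allVec-unique m)) heads-differ
  where
  heads-differ : Disjoint (map (false Vec.∷_) (allVec m)) (map (true Vec.∷_) (allVec m))
  heads-differ (p , q) with ∈-map⁻ (false Vec.∷_) p | ∈-map⁻ (true Vec.∷_) q
  ... | _ , _ , refl | _ , _ , ()

map-not-involutive : ∀ {m} (v : Vec Bool m) → Vec.map not (Vec.map not v) ≡ v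
map-not-involutive v = trans (sym (map-∘ not not v)) (trans (map-cong not-involutive v) (map-id v))

complementPair : ∀ {n} → Config n → List (Config n)
complementPair ℓ = ℓ ∷ Vec.map not ℓ ∷ []

withComplements : ∀ {n} → List (Config n) → List (Config n)
withComplements = concatMap complementPair

module _ {m : ℕ} where
  private
    V : Set
    V = Vec Bool m

  complementPairs-disjoint : {t u : V} → t ≢ u →
                             Disjoint (complementPair (false Vec.∷ t)) (complementPair (false Vec.∷ u))
  complementPairs-disjoint t≢u (here refl , here refl) = t≢u refl
  complementPairs-disjoint t≢u (here refl , there (here ()))
  complementPairs-disjoint t≢u (there (here refl) , here ())
  complementPairs-disjoint {t} {u} t≢u (there (here refl) , there (here ¬t≡¬u)) =
    t≢u (trans (sym (map-not-involutive t)) (trans (cong (Vec.map not) (∷-injectiveʳ ¬t≡¬u)) (map-not-involutive u)))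

  withComplements-unique : (ts : List V) → Unique ts → Unique (withComplements (map (false Vec.∷_) ts))
  withComplements-unique ts ts! = subst Unique (sym (concatMap-map complementPair (false Vec.∷_) ts))
    (Unique.concat⁺ (All.tabulate λ p → case-pair p) (AllPairs.map⁺ (AllPairs.map complementPairs-disjoint ts!)))
    where
    case-pair : ∀ {ps} → ps ∈ map (complementPair ∘ (false Vec.∷_)) ts → Unique ps
    case-pair p with ∈-map⁻ (complementPair ∘ (false Vec.∷_)) p
    ... | _ , _ , refl = ((λ ()) ∷ []) ∷ [] ∷ []

  -- A fresh pair {false ∷ t , true ∷ ¬t} is blocked by at most one used label, via its canonical tail.
  canonicalTail : Vec Bool (suc m) → V
  canonicalTail (false Vec.∷ v) = v
  canonicalTail (true Vec.∷ v) = Vec.map not v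

  Fresh : List (Config (suc m)) → V → Set
  Fresh U t = (false Vec.∷ t) ∉ U × (true Vec.∷ Vec.map not t) ∉ U

  fresh? : (U : List (Config (suc m))) → Decidable₁ (Fresh U)
  fresh? U t = ¬? (member? _≟ᶜ_ (false Vec.∷ t) U) ×-dec ¬? (member? _≟ᶜ_ (true Vec.∷ Vec.map not t) U)

  blocked⊆canonicalTails : (U : List (Config (suc m))) →
                           ∀ {t} → t ∈ filter (∁? (fresh? U)) (allVec m) → t ∈ map canonicalTail U
  blocked⊆canonicalTails U {t} p with member? _≟ᶜ_ (false Vec.∷ t) U | member? _≟ᶜ_ (true Vec.∷ Vec.map not t) U
  ... | yes t∈U | _ = ∈-map⁺ canonicalTail t∈U
  ... | no _ | yes ¬t∈U = subst (_∈ map canonicalTail U) (map-not-involutive t) (∈-map⁺ canonicalTail ¬t∈U)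
  ... | no t∉U | no ¬t∉U = ⊥-elim (proj₂ (∈-filter⁻ (∁? (fresh? U)) {xs = allVec m} p) (t∉U , ¬t∉U))

  fresh-tails : (U : List (Config (suc m))) (q : ℕ) → q + length U ≤ 2 ^ m →
                Σ (List V) λ ts → length ts ≡ q × Unique ts × All (Fresh U) ts
  fresh-tails U q bound = take q F , length-take-F , Unique.take⁺ q (Unique.filter⁺ (fresh? U) (allVec-unique m))
                        , All.tabulate λ p → proj₂ (∈-filter⁻ (fresh? U) {xs = allVec m} (∈-take⁻ q F p))
    where
    F B : List V
    F = filter (fresh? U) (allVec m)
    B = filter (∁? (fresh? U)) (allVec m)
    |B|≤|U| : length B ≤ length U
    |B|≤|U| = ≤-trans (unique-length-≤ (Unique.filter⁺ (∁? (fresh? U)) (allVec-unique m)) (blocked⊆canonicalTails U))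
                      (≤-reflexive (length-map canonicalTail U))
    q≤|F| : q ≤ length F
    q≤|F| = +-cancelʳ-≤ (length U) q (length F) (begin
      q + length U           ≤⟨ bound ⟩
      2 ^ m                  ≡⟨ sym (length-allVec m) ⟩
      length (allVec m)      ≡⟨ length-filter-∁ (fresh? U) (allVec m) ⟨
      length F + length B    ≤⟨ +-monoʳ-≤ (length F) |B|≤|U| ⟩
      length F + length U    ∎)
      where open ≤-Reasoning
    length-take-F : length (take q F) ≡ q
    length-take-F = length-take-≤ q≤|F|

fresh-complementary-labels : ∀ {n} → 1 ≤ n → (U : List (Config n)) (q : ℕ) → q + length U ≤ 2 ^ (n ∸ 1) →
  Σ (List (Config n)) λ ℓs → length ℓs ≡ q × Unique (withComplements ℓs) × (∀ {v} → v ∈ withComplements ℓs → v ∉ U)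
fresh-complementary-labels {suc m} _ U q bound with fresh-tails U q bound
... | ts , |ts|≡q , ts! , fresh =
  map (false Vec.∷_) ts , trans (length-map _ ts) |ts|≡q , withComplements-unique ts ts! , avoids-U
  where
  avoids-U : ∀ {v} → v ∈ withComplements (map (false Vec.∷_) ts) → v ∉ U
  avoids-U p with find (∈-concatMap⁻ (complementPair ∘ (false Vec.∷_)) {xs = ts}
                          (subst (_ ∈_) (concatMap-map complementPair (false Vec.∷_) ts) p))
  ... | t , t∈ts , here refl = proj₁ (All.lookup fresh t∈ts)
  ... | t , t∈ts , there (here refl) = proj₂ (All.lookup fresh t∈ts)

3n≤2^[n-1] : ∀ {n} → 5 ≤ n → 3 * n ≤ 2 ^ (n ∸ 1)
3n≤2^[n-1] {n} 5≤n = subst (λ m → 3 * m ≤ 2 ^ (m ∸ 1)) (m+[n∸m]≡n 5≤n) (from-5 (n ∸ 5))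
  where
  from-5 : ∀ k → 3 * (5 + k) ≤ 2 ^ (4 + k)
  from-5 zero = from-yes (15 ≤? 16)
  from-5 (suc k) = begin
    3 * (6 + k)            ≡⟨ *-distribˡ-+ 3 1 (5 + k) ⟩
    3 + 3 * (5 + k)        ≤⟨ +-mono-≤ (≤-trans (from-yes (3 ≤? 16)) (^-monoʳ-≤ 2 (m≤m+n 4 k))) (from-5 k) ⟩
    2 ^ (4 + k) + 2 ^ (4 + k) ≡⟨ cong (2 ^ (4 + k) +_) (sym (+-identityʳ _)) ⟩
    2 ^ (5 + k)            ∎
    where open ≤-Reasoning

module _ {n : ℕ} where
  private
    C : Set
    C = Config n

  spokes : Bits → ℕ → List C → List (C × C)
  spokes b o [] = []
  spokes b o (y ∷ ys) = (y , fromBits (b ⊕ bit o)) ∷ spokes b (suc o) ys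

  spokes-points : ∀ b o ys → map proj₁ (spokes b o ys) ≡ ys
  spokes-points b o [] = refl
  spokes-points b o (y ∷ ys) = cong (y ∷_) (spokes-points b (suc o) ys)

  ∈-spokes-labels : ∀ b o ys {v} → v ∈ map proj₂ (spokes b o ys) →
                    Σ ℕ λ i → i < length ys × v ≡ fromBits (b ⊕ bit (o + i))
  ∈-spokes-labels b o (y ∷ ys) (here refl) = 0 , s≤s z≤n , cong (λ k → fromBits (b ⊕ bit k)) (sym (+-identityʳ o))
  ∈-spokes-labels b o (y ∷ ys) (there p) with ∈-spokes-labels b (suc o) ys p
  ... | i , i<|ys| , refl = suc i , s≤s i<|ys| , cong (λ k → fromBits (b ⊕ bit k)) (sym (+-suc o i))

  spoke : ∀ b o ys {i} → i < length ys → Σ C λ y → y ∈ ys × (y , fromBits (b ⊕ bit (o + i))) ∈ spokes b o ys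
  spoke b o (y ∷ ys) {zero} _ =
    y , here refl , subst (λ k → (y , fromBits (b ⊕ bit k)) ∈ spokes b o (y ∷ ys)) (sym (+-identityʳ o)) (here refl)
  spoke b o (y ∷ ys) {suc i} (s≤s i<|ys|) with spoke b (suc o) ys i<|ys|
  ... | y′ , y′∈ys , p =
    y′ , there y′∈ys , subst (λ k → (y′ , fromBits (b ⊕ bit k)) ∈ spokes b o (y ∷ ys)) (sym (+-suc o i)) (there p)

  spokes-labels-unique : ∀ b o ys → o + length ys ≤ n → Unique (map proj₂ (spokes b o ys))
  spokes-labels-unique b o [] _ = []
  spokes-labels-unique b o (y ∷ ys) bound =
    All.tabulate first-fresh ∷ spokes-labels-unique b (suc o) ys (subst (_≤ n) (+-suc o (length ys)) bound)
    where
    first-fresh : ∀ {v} → v ∈ map proj₂ (spokes b (suc o) ys) → fromBits (b ⊕ bit o) ≢ v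
    first-fresh p with ∈-spokes-labels b (suc o) ys p
    ... | i , _ , refl = ⊕-bit-injective b (≤-trans (s≤s (m≤m+n o (length ys))) (subst (_≤ n) (+-suc o (length ys)) bound))
                                          (λ o≡1+o+i → <-irrefl o≡1+o+i (s≤s (m≤m+n o i)))

-- A single output class: a star around a point outside the class

module SingleClass {n : ℕ} (5≤n : 5 ≤ n) (f : BN n) (A : List (Config n)) (A! : Unique A)
                   (independent : ∀ x → x ∈ A → f x ∉ A) (1+n≤|A| : suc n ≤ length A)
                   (c : Config n) (f[A]≡c : ∀ {a} → a ∈ A → f a ≡ c) (z : Config n) (fz≢c : f z ≢ c) where
  private
    C : Set
    C = Config n
    d : C
    d = f z

  2≤n : 2 ≤ n
  2≤n = ≤-trans (s≤s (s≤s z≤n)) 5≤n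

  c∉A : c ∉ A
  c∉A c∈A = independent c c∈A (subst (_∈ A) (sym (f[A]≡c c∈A)) c∈A)

  z∉A : z ∉ A
  z∉A z∈A = fz≢c (f[A]≡c z∈A)

  others leaves : List C
  others = filter (¬? ∘ (_≟ᶜ d)) A
  leaves = take n others

  n≤|others| : n ≤ length others
  n≤|others| = ≤-pred (begin
    suc n                                             ≤⟨ 1+n≤|A| ⟩
    length A                                          ≡⟨ length-filter-∁ (_≟ᶜ d) A ⟨
    length (filter (_≟ᶜ d) A) + length others         ≤⟨ +-monoˡ-≤ _ (unique-length-≤ (Unique.filter⁺ (_≟ᶜ d) A!) ∈-[d]) ⟩
    suc (length others)                               ∎)
    where
    open ≤-Reasoning
    ∈-[d] : ∀ {x} → x ∈ filter (_≟ᶜ d) A → x ∈ d ∷ []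
    ∈-[d] p = here (proj₂ (∈-filter⁻ (_≟ᶜ d) {xs = A} p))

  |leaves|≡n : length leaves ≡ n
  |leaves|≡n = length-take-≤ n≤|others|

  leaf-in-others : ∀ {x} → x ∈ leaves → x ∈ others
  leaf-in-others = ∈-take⁻ n others

  leaf-in-A : ∀ {x} → x ∈ leaves → x ∈ A
  leaf-in-A p = proj₁ (∈-filter⁻ (¬? ∘ (_≟ᶜ d)) {xs = A} (leaf-in-others p))

  leaf-≢-d : ∀ {x} → x ∈ leaves → x ≢ d
  leaf-≢-d p = proj₂ (∈-filter⁻ (¬? ∘ (_≟ᶜ d)) {xs = A} (leaf-in-others p))

  origin ones : C
  origin = fromBits (const false)
  ones = fromBits (const true)

  S : List (C × C)
  S = (z , origin) ∷ spokes (const false) 0 leaves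

  points-S : map proj₁ S ≡ z ∷ leaves
  points-S = cong (z ∷_) (spokes-points (const false) 0 leaves)

  ∉-points-S : ∀ {w} → w ≢ z → w ∉ leaves → w ∉ map proj₁ S
  ∉-points-S {w} w≢z w∉leaves p with subst (w ∈_) points-S p
  ... | here w≡z = w≢z w≡z
  ... | there w∈leaves = w∉leaves w∈leaves

  c∉points-S : z ≢ c → c ∉ map proj₁ S
  c∉points-S z≢c = ∉-points-S (z≢c ∘ sym) (c∉A ∘ leaf-in-A)

  d∉points-S : z ≢ d → d ∉ map proj₁ S
  d∉points-S z≢d = ∉-points-S (z≢d ∘ sym) (λ d∈leaves → leaf-≢-d d∈leaves refl)

  points-S-unique : Unique (map proj₁ S)
  points-S-unique = subst Unique (sym points-S)
    (All.tabulate (λ x∈leaves z≡x → z∉A (subst (_∈ A) (sym z≡x) (leaf-in-A x∈leaves)))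
      ∷ Unique.take⁺ n (Unique.filter⁺ _ A!))

  labels-S-unique : Unique (map proj₂ S)
  labels-S-unique = All.tabulate origin-fresh ∷ spokes-labels-unique (const false) 0 leaves (≤-reflexive |leaves|≡n)
    where
    origin-fresh : ∀ {v} → v ∈ map proj₂ (spokes (const false) 0 leaves) → origin ≢ v
    origin-fresh p with ∈-spokes-labels (const false) 0 leaves p
    ... | i , i<n , refl = fromBits-≢-not (const false) (const false ⊕ bit i) (subst (i <_) |leaves|≡n i<n)
                                            (⊕-bit-self (const false) i)

  ones-≢-spoke : ∀ i → ones ≢ fromBits (const false ⊕ bit i)
  ones-≢-spoke zero = fromBits-≢ (const true) (const false ⊕ bit 0) {1} 2≤n (λ ())
  ones-≢-spoke (suc i) = fromBits-≢ (const true) (const false ⊕ bit (suc i)) {0} (≤-trans (s≤s z≤n) 2≤n) (λ ())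

  ones-∉-labels-S : ones ∉ map proj₂ S
  ones-∉-labels-S (here ones≡origin) = fromBits-≢ (const true) (const false) {0} (≤-trans (s≤s z≤n) 2≤n) (λ ()) ones≡origin
  ones-∉-labels-S (there p) with ∈-spokes-labels (const false) 0 leaves p
  ... | i , _ , ones≡eᵢ = ones-≢-spoke i ones≡eᵢ

  ones#origin : Complementary ones origin
  ones#origin = subst (λ v → Complementary v origin) (map-not-fromBits (const false)) (map-not-complementary origin)

  -- In direction j the centre z and the j-th leaf are adjacent; their images are d and c.
  completed-by : (T : List (C × C)) {ℓd ℓc : C} → Unique (map proj₁ T) → Unique (map proj₂ T) →
                 (∀ {w} → w ∈ map proj₁ T → w ∉ map proj₁ S) → (∀ {ℓ} → ℓ ∈ map proj₂ T → ℓ ∉ map proj₂ S) →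
                 (d , ℓd) ∈ S ++ T → (c , ℓc) ∈ S ++ T → Complementary ℓd ℓc → CompleteInIsoClass f
  completed-by T {ℓd} {ℓc} T-points! T-labels! T-points-new T-labels-new d↦ℓd c↦ℓc ℓd#ℓc =
    labelling-complete f (S ++ T)
      (unique-map-++ proj₁ S T points-S-unique T-points! λ (p , q) → T-points-new q p)
      (unique-map-++ proj₂ S T labels-S-unique T-labels! λ (p , q) → T-labels-new q p)
      edge
    where
    in-S : ∀ {p} → p ∈ S → p ∈ S ++ T
    in-S = ∈-++⁺ˡ
    edge : ∀ j → LabelledEdge f (S ++ T) j
    edge j with spoke (const false) 0 leaves (subst (toℕ j <_) (sym |leaves|≡n) (toℕ<n j))
    ... | x , x∈leaves , x↦eⱼ = record
      { x₁ = z ; x₂ = x ; y = origin ; ℓ₁ = ℓd ; ℓ₂ = ℓc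
      ; x₁↦y = in-S (here refl)
      ; x₂↦flipped-y = in-S (there (subst (λ v → (x , v) ∈ spokes (const false) 0 leaves)
                                          (sym (flipAt-fromBits j (const false))) x↦eⱼ))
      ; fx₁↦ℓ₁ = d↦ℓd
      ; fx₂↦ℓ₂ = subst (λ w → (w , ℓc) ∈ S ++ T) (sym (f[A]≡c (leaf-in-A x∈leaves))) c↦ℓc
      ; ℓ₁#ℓ₂ = ℓd#ℓc }

  z↦origin : (z , origin) ∈ S
  z↦origin = here refl

  complete : CompleteInIsoClass f
  complete with z ≟ᶜ c | z ≟ᶜ d
  ... | yes z≡c | _ = completed-by ((d , ones) ∷ []) ([] ∷ []) ([] ∷ [])
    (λ { (here refl) → d∉points-S λ z≡d → fz≢c (trans (sym z≡d) z≡c) }) (λ { (here refl) → ones-∉-labels-S })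
    (∈-++⁺ʳ S (here refl)) (∈-++⁺ˡ (subst (λ w → (w , origin) ∈ S) z≡c z↦origin)) ones#origin
  ... | no z≢c | yes z≡d = completed-by ((c , ones) ∷ []) ([] ∷ []) ([] ∷ [])
    (λ { (here refl) → c∉points-S z≢c }) (λ { (here refl) → ones-∉-labels-S })
    (∈-++⁺ˡ (subst (λ w → (w , origin) ∈ S) z≡d z↦origin)) (∈-++⁺ʳ S (here refl))
    (complementary-sym {u = ones} {origin} ones#origin)
  ... | no z≢c | no z≢d with fresh-complementary-labels (≤-trans (s≤s z≤n) 5≤n) (map proj₂ S) 1 bound
    where
    bound : 1 + length (map proj₂ S) ≤ 2 ^ (n ∸ 1)
    bound = begin
      1 + length (map proj₂ S)  ≡⟨ cong suc (trans (length-map proj₂ S) (trans (sym (length-map proj₁ S)) (cong length points-S))) ⟩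
      2 + length leaves         ≡⟨ cong (2 +_) |leaves|≡n ⟩
      2 + n                     ≤⟨ +-monoˡ-≤ n (≤-trans 2≤n (m≤m+n n (n + 0))) ⟩
      2 * n + n                 ≡⟨ +-comm (2 * n) n ⟩
      3 * n                     ≤⟨ 3n≤2^[n-1] 5≤n ⟩
      2 ^ (n ∸ 1)               ∎
      where open ≤-Reasoning
  ... | ℓ ∷ [] , _ , ℓ-pair! , ℓ-pair-fresh = completed-by ((c , ℓ) ∷ (d , Vec.map not ℓ) ∷ [])
    (((fz≢c ∘ sym) ∷ []) ∷ [] ∷ []) ℓ-pair!
    (λ { (here refl) → c∉points-S z≢c ; (there (here refl)) → d∉points-S z≢d }) ℓ-pair-fresh
    (∈-++⁺ʳ S (there (here refl))) (∈-++⁺ʳ S (here refl)) (map-not-complementary ℓ)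

-- Caterpillars: x₀ is joined to the ys in directions o, o+1, …, and the first y to the xs in the next directions

Outside : ℕ → ℕ → ℕ → Set
Outside o w c = c < o ⊎ o + w ≤ c

outside-≢ : ∀ {o w c d} → o ≤ d → d < o + w → Outside o w c → c ≢ d
outside-≢ o≤d _ (inj₁ c<o) refl = <-irrefl refl (≤-trans c<o o≤d)
outside-≢ _ d<o+w (inj₂ o+w≤c) refl = <-irrefl refl (≤-trans d<o+w o+w≤c)

-- These properties of a label alone separate the labels of caterpillars on disjoint blocks.
record Tagged {n : ℕ} (o w tg : ℕ) (v : Config n) : Set where
  field
    g : Bits
    v≡ : v ≡ fromBits (bit tg ⊕ g)
    outside : ∀ c → Outside o w c → g c ≡ false
    not-first : 2 ≤ w → Σ ℕ λ c → o ≤ c × c < o + w × g c ≢ bit o c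

-- The offset ext keeps every label of a wide caterpillar away from the pattern e_o on its block.
ExtShape : ℕ → ℕ → ℕ → Bits → Set
ExtShape o ty w ext = (w ≤ 1 × (∀ c → ext c ≡ false)) ⊎ (2 ≤ ty × (∀ c → ext c ≡ bit (suc o) c))

extShape : ∀ o ty w → w ≤ 1 ⊎ 2 ≤ ty → Σ Bits (ExtShape o ty w)
extShape o ty w (inj₁ w≤1) = const false , inj₁ (w≤1 , λ _ → refl)
extShape o ty w (inj₂ 2≤ty) = bit (suc o) , inj₂ (2≤ty , λ _ → refl)

module Caterpillar {n : ℕ} (o tg : ℕ) (ext : Bits) (x₀ : Config n) (ys xs : List (Config n)) where
  private
    C : Set
    C = Config n

  w : ℕ
  w = length ys + length xs
  base base′ : Bits
  base = bit tg ⊕ ext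
  base′ = base ⊕ bit o
  Sy Sx : List (C × C)
  Sy = spokes base o ys
  Sx = spokes base′ (o + length ys) xs

  pairs : List (C × C)
  pairs = (x₀ , fromBits base) ∷ (Sy ++ Sx)

  pairs-points : map proj₁ pairs ≡ x₀ ∷ (ys ++ xs)
  pairs-points = cong (x₀ ∷_) (trans (map-++ proj₁ Sy Sx)
                                     (cong₂ _++_ (spokes-points base o ys) (spokes-points base′ (o + length ys) xs)))

  pairs-labels : map proj₂ pairs ≡ fromBits base ∷ (map proj₂ Sy ++ map proj₂ Sx)
  pairs-labels = cong (fromBits base ∷_) (map-++ proj₂ Sy Sx)

  data LabelForm (v : C) : Set where
    root-label : v ≡ fromBits base → LabelForm v
    y-label : ∀ i → i < length ys → v ≡ fromBits (base ⊕ bit (o + i)) → LabelForm v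
    x-label : ∀ i → i < length xs → v ≡ fromBits (base′ ⊕ bit (o + length ys + i)) → LabelForm v

  labelForm : ∀ {v} → v ∈ map proj₂ pairs → LabelForm v
  labelForm {v} p with subst (v ∈_) pairs-labels p
  ... | here v≡ = root-label v≡
  ... | there q with ∈-++⁻ (map proj₂ Sy) q
  ...   | inj₁ r = let (i , i< , v≡) = ∈-spokes-labels base o ys r in y-label i i< v≡
  ...   | inj₂ r = let (i , i< , v≡) = ∈-spokes-labels base′ (o + length ys) xs r in x-label i i< v≡

  module _ (fits : o + w ≤ n) (1≤|ys| : 1 ≤ length ys) where
    private
      ty : ℕ
      ty = length ys

    y-coord< : ∀ {i} → i < ty → o + i < n
    y-coord< i<ty = ≤-trans (+-monoʳ-< o (≤-trans i<ty (m≤m+n ty _))) fits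

    x-coord< : ∀ {i} → i < length xs → o + ty + i < n
    x-coord< i<tx = ≤-trans (≤-reflexive (cong suc (+-assoc o ty _))) (≤-trans (+-monoʳ-< o (+-monoʳ-< ty i<tx)) fits)

    x-coord≢y-coord : ∀ {i k} → i < ty → o + ty + k ≢ o + i
    x-coord≢y-coord {i} {k} i<ty eq = <-irrefl (sym eq) (≤-trans (+-monoʳ-< o i<ty) (m≤m+n (o + ty) k))

    x-coord≢o : ∀ {k} → o + ty + k ≢ o
    x-coord≢o {k} eq = x-coord≢y-coord {0} {k} 1≤|ys| (trans eq (sym (+-identityʳ o)))

    labels-unique : Unique (map proj₂ pairs)
    labels-unique = subst Unique (sym pairs-labels)
      (All.tabulate root-fresh ∷ Unique.++⁺ (spokes-labels-unique base o ys (≤-trans (+-monoʳ-≤ o (m≤m+n ty _)) fits))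
                                           (spokes-labels-unique base′ (o + ty) xs (≤-trans (≤-reflexive (+-assoc o ty _)) fits))
                                           Sy#Sx)
      where
      root-fresh : ∀ {v} → v ∈ map proj₂ Sy ++ map proj₂ Sx → fromBits base ≢ v
      root-fresh p with ∈-++⁻ (map proj₂ Sy) p
      ... | inj₁ q with ∈-spokes-labels base o ys q
      ...   | i , i<ty , refl = fromBits-≢-not base (base ⊕ bit (o + i)) (y-coord< i<ty) (⊕-bit-self base (o + i))
      root-fresh p | inj₂ q with ∈-spokes-labels base′ (o + ty) xs q
      ...   | k , k<tx , refl = fromBits-≢-not base (base′ ⊕ bit (o + ty + k)) (x-coord< k<tx)
                                  (trans (⊕-bit-self base′ (o + ty + k)) (cong not (⊕-bit-other base x-coord≢o)))
      Sy#Sx : Disjoint (map proj₂ Sy) (map proj₂ Sx)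
      Sy#Sx (p , q) with ∈-spokes-labels base o ys p | ∈-spokes-labels base′ (o + ty) xs q
      ... | i , i<ty , refl | k , k<tx , eq = fromBits-≢-not (base ⊕ bit (o + i)) (base′ ⊕ bit (o + ty + k)) (x-coord< k<tx)
            (trans (⊕-bit-self base′ (o + ty + k))
                   (cong not (trans (⊕-bit-other base x-coord≢o) (sym (⊕-bit-other base (x-coord≢y-coord i<ty))))))
            eq

    module _ (shape : ExtShape o ty w ext) where
      private
        2≤ty⇒2≤w : 2 ≤ ty → 2 ≤ w
        2≤ty⇒2≤w 2≤ty = ≤-trans 2≤ty (m≤m+n ty (length xs))
        1+o<o+w : 2 ≤ w → suc o < o + w
        1+o<o+w 2≤w = subst (_≤ o + w) (+-comm o 2) (+-monoʳ-≤ o 2≤w)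
        o<o+w : o < o + w
        o<o+w = subst (_≤ o + w) (+-comm o 1) (+-monoʳ-≤ o (≤-trans 1≤|ys| (m≤m+n ty (length xs))))
        1+o≢o : suc o ≢ o
        1+o≢o eq = <-irrefl (sym eq) (n<1+n o)

      ext-outside : ∀ c → Outside o w c → ext c ≡ false
      ext-outside c c-out = by shape
        where
        by : ExtShape o ty w ext → ext c ≡ false
        by (inj₁ (_ , ext≗0)) = ext≗0 c
        by (inj₂ (2≤ty , ext≗e₁)) = trans (ext≗e₁ c) (bit-other (outside-≢ (n≤1+n o) (1+o<o+w (2≤ty⇒2≤w 2≤ty)) c-out))

      wide : 2 ≤ w → 2 ≤ ty × (∀ c → ext c ≡ bit (suc o) c)
      wide 2≤w = by shape
        where
        by : ExtShape o ty w ext → 2 ≤ ty × (∀ c → ext c ≡ bit (suc o) c)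
        by (inj₁ (w≤1 , _)) = ⊥-elim (<-irrefl refl (≤-trans 2≤w w≤1))
        by (inj₂ shape₂) = shape₂

      differs-at-1+o : ∀ (g : Bits) → 2 ≤ w → g (suc o) ≡ true → Σ ℕ λ c → o ≤ c × c < o + w × g c ≢ bit o c
      differs-at-1+o g 2≤w g[1+o]≡true = suc o , n≤1+n o , 1+o<o+w 2≤w ,
        λ eq → not-≢ false (trans (trans (sym g[1+o]≡true) eq) (bit-other 1+o≢o))

      differs-at-o : ∀ (g : Bits) → g o ≡ false → Σ ℕ λ c → o ≤ c × c < o + w × g c ≢ bit o c
      differs-at-o g go≡false = o , ≤-refl , o<o+w , λ eq → not-≢ false (trans (trans (sym (bit-self o)) (sym eq)) go≡false)

      ext[1+o] : 2 ≤ w → ext (suc o) ≡ true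
      ext[1+o] 2≤w = trans (proj₂ (wide 2≤w) (suc o)) (bit-self (suc o))

      root-tagged : Tagged o w tg (fromBits {n} base)
      root-tagged = record
        { g = ext ; v≡ = refl ; outside = ext-outside
        ; not-first = λ 2≤w → differs-at-1+o ext 2≤w (ext[1+o] 2≤w) }

      y-tagged : ∀ i → i < ty → Tagged o w tg (fromBits {n} (base ⊕ bit (o + i)))
      y-tagged i i<ty = record
        { g = ext ⊕ bit (o + i)
        ; v≡ = fromBits-≗ (⊕-assoc (bit tg) ext (bit (o + i)))
        ; outside = λ c c-out → trans (⊕-bit-other ext (outside-≢ (m≤m+n o i) o+i<o+w c-out)) (ext-outside c c-out)
        ; not-first = not-first }
        where
        o+i<o+w : o + i < o + w
        o+i<o+w = +-monoʳ-< o (≤-trans i<ty (m≤m+n ty (length xs)))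
        -- The witness is o + 1, where ext is set, except for the y-label whose spoke cancels it.
        not-first : 2 ≤ w → Σ ℕ λ c → o ≤ c × c < o + w × (ext ⊕ bit (o + i)) c ≢ bit o c
        not-first 2≤w with i ≟ 1
        ... | yes refl = differs-at-o (ext ⊕ bit (o + 1)) (trans (⊕-bit-other ext (λ o≡o+1 → 1+o≢o (sym (trans o≡o+1 (+-comm o 1)))))
                                                              (trans (proj₂ (wide 2≤w) o) (bit-other (1+o≢o ∘ sym))))
        ... | no i≢1 = differs-at-1+o (ext ⊕ bit (o + i)) 2≤w (trans (⊕-bit-other ext 1+o≢o+i) (ext[1+o] 2≤w))
          where
          1+o≢o+i : suc o ≢ o + i
          1+o≢o+i eq = i≢1 (+-cancelˡ-≡ o i 1 (trans (sym eq) (+-comm 1 o)))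

      x-tagged : ∀ k → k < length xs → Tagged o w tg (fromBits {n} (base′ ⊕ bit (o + ty + k)))
      x-tagged k k<tx = record
        { g = (ext ⊕ bit o) ⊕ bit p
        ; v≡ = fromBits-≗ λ c → trans (cong (_xor bit p c) (⊕-assoc (bit tg) ext (bit o) c))
                                      (⊕-assoc (bit tg) (ext ⊕ bit o) (bit p) c)
        ; outside = λ c c-out → trans (⊕-bit-other (ext ⊕ bit o) (outside-≢ o≤p p<o+w c-out))
                                 (trans (⊕-bit-other ext (outside-≢ ≤-refl o<o+w c-out)) (ext-outside c c-out))
        ; not-first = λ 2≤w → differs-at-1+o ((ext ⊕ bit o) ⊕ bit p) 2≤w
            (trans (⊕-bit-other (ext ⊕ bit o) (1+o≢p 2≤w)) (trans (⊕-bit-other ext 1+o≢o) (ext[1+o] 2≤w))) }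
        where
        p : ℕ
        p = o + ty + k
        o≤p : o ≤ p
        o≤p = ≤-trans (m≤m+n o ty) (m≤m+n (o + ty) k)
        p<o+w : p < o + w
        p<o+w = subst (_< o + w) (sym (+-assoc o ty k)) (+-monoʳ-< o (+-monoʳ-< ty k<tx))
        1+o≢p : 2 ≤ w → suc o ≢ p
        1+o≢p 2≤w eq = <-irrefl eq (≤-trans (subst (_≤ o + ty) (+-comm o 2) (+-monoʳ-≤ o (proj₁ (wide 2≤w))))
                                            (m≤m+n (o + ty) k))

      tagged : ∀ {v} → v ∈ map proj₂ pairs → Tagged o w tg v
      tagged p with labelForm p
      ... | root-label refl = root-tagged
      ... | y-label i i<ty refl = y-tagged i i<ty
      ... | x-label k k<tx refl = x-tagged k k<tx

    record Edge (j : Fin n) : Set where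
      field
        u v y : C
        u↦y : (u , y) ∈ pairs
        v↦flipped-y : (v , flipAt j y) ∈ pairs
        ends : (u ≡ x₀ × v ∈ ys) ⊎ (u ∈ ys × v ∈ xs)

    root-edge : ∀ {i} → i < ty → (j : Fin n) → toℕ j ≡ o + i → Edge j
    root-edge i<ty j j≡o+i with spoke base o ys i<ty
    ... | y′ , y′∈ys , y′↦ = record
      { u = x₀ ; v = y′ ; y = fromBits base ; u↦y = here refl
      ; v↦flipped-y = there (∈-++⁺ˡ (subst (λ ℓ → (y′ , ℓ) ∈ Sy) label≡ y′↦))
      ; ends = inj₁ (refl , y′∈ys) }
      where
      label≡ : fromBits (base ⊕ bit _) ≡ flipAt j (fromBits base)
      label≡ = trans (cong (λ k → fromBits (base ⊕ bit k)) (sym j≡o+i)) (sym (flipAt-fromBits j base))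

    first-y-edge : ∀ {k} → k < length xs → (j : Fin n) → toℕ j ≡ o + ty + k → Edge j
    first-y-edge k<tx j j≡o+ty+k with spoke base o ys 1≤|ys| | spoke base′ (o + ty) xs k<tx
    ... | y₀ , y₀∈ys , y₀↦ | x′ , x′∈xs , x′↦ = record
      { u = y₀ ; v = x′ ; y = fromBits (base ⊕ bit (o + 0))
      ; u↦y = there (∈-++⁺ˡ y₀↦)
      ; v↦flipped-y = there (∈-++⁺ʳ Sy (subst (λ ℓ → (x′ , ℓ) ∈ Sx) label≡ x′↦))
      ; ends = inj₂ (y₀∈ys , x′∈xs) }
      where
      label≡ : fromBits (base′ ⊕ bit (o + ty + _)) ≡ flipAt j (fromBits (base ⊕ bit (o + 0)))
      label≡ = begin
        fromBits (base′ ⊕ bit (o + ty + _))            ≡⟨ cong (λ k → fromBits (base′ ⊕ bit k)) (sym j≡o+ty+k) ⟩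
        fromBits (base′ ⊕ bit (toℕ j))                 ≡⟨ cong (λ k → fromBits ((base ⊕ bit k) ⊕ bit (toℕ j))) (+-identityʳ o) ⟨
        fromBits ((base ⊕ bit (o + 0)) ⊕ bit (toℕ j))  ≡⟨ flipAt-fromBits j (base ⊕ bit (o + 0)) ⟨
        flipAt j (fromBits (base ⊕ bit (o + 0)))       ∎
        where open ≡-Reasoning

    edge : (j : Fin n) → o ≤ toℕ j → toℕ j < o + w → Edge j
    edge j o≤j j<o+w with toℕ j <? o + ty
    ... | yes j<o+ty = root-edge (+-cancelˡ-< o (toℕ j ∸ o) ty (subst (_< o + ty) (sym o+[j-o]≡j) j<o+ty)) j (sym o+[j-o]≡j)
      where
      o+[j-o]≡j : o + (toℕ j ∸ o) ≡ toℕ j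
      o+[j-o]≡j = m+[n∸m]≡n o≤j
    ... | no j≮o+ty = first-y-edge (+-cancelˡ-< (o + ty) (toℕ j ∸ (o + ty)) (length xs)
                                     (subst₂ _<_ (sym o+ty+[j-o-ty]≡j) (sym (+-assoc o ty (length xs))) j<o+w))
                                   j (sym o+ty+[j-o-ty]≡j)
      where
      o+ty+[j-o-ty]≡j : o + ty + (toℕ j ∸ (o + ty)) ≡ toℕ j
      o+ty+[j-o-ty]≡j = m+[n∸m]≡n (≮⇒≥ j≮o+ty)

TagOf : ℕ → ℕ → ℕ → ℕ → Set
TagOf n o w tg = (o + w < n × tg ≡ o + w) ⊎ (o + w ≡ n × tg ≡ 0)

module Separation {n a wA b wB tA tB : ℕ} (5≤n : 5 ≤ n) (1≤wA : 1 ≤ wA) (1≤wB : 1 ≤ wB)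
                  (a+wA≤b : a + wA ≤ b) (b+wB≤n : b + wB ≤ n) (tA≡ : tA ≡ a + wA)
                  {ℓA ℓB : Config n} (TA : Tagged a wA tA ℓA) (TB : Tagged b wB tB ℓB) (ℓA≡ℓB : ℓA ≡ ℓB) where
  private
    module A = Tagged TA
    module B = Tagged TB

    differ-at : ∀ {c} → c < n → (bit tA ⊕ A.g) c ≢ (bit tB ⊕ B.g) c → ⊥
    differ-at c<n ne = fromBits-≢ (bit tA ⊕ A.g) (bit tB ⊕ B.g) c<n ne (trans (sym A.v≡) (trans ℓA≡ℓB B.v≡))

    true≢false : true ≢ false
    true≢false ()

    b<n : b < n
    b<n = ≤-trans (subst (_≤ b + wB) (+-comm b 1) (+-monoʳ-≤ b 1≤wB)) b+wB≤n

    1≤a+wA : 1 ≤ a + wA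
    1≤a+wA = ≤-trans 1≤wA (m≤n+m wA a)

  gap : TagOf n b wB tB → a + wA < b → ⊥
  gap tagB a+wA<b = differ-at (<-trans a+wA<b b<n) λ eq → true≢false (trans (sym A-at-c) (trans eq B-at-c))
    where
    c = a + wA
    A-at-c : (bit tA ⊕ A.g) c ≡ true
    A-at-c = trans (⊕-false (bit tA) A.g (A.outside c (inj₂ ≤-refl))) (trans (cong (λ t → bit t c) tA≡) (bit-self c))
    c≢tB : TagOf n b wB tB → c ≢ tB
    c≢tB (inj₁ (_ , tB≡)) c≡tB = <-irrefl (trans c≡tB tB≡) (≤-trans a+wA<b (m≤m+n b wB))
    c≢tB (inj₂ (_ , tB≡0)) c≡tB = <-irrefl (sym (trans c≡tB tB≡0)) 1≤a+wA
    B-at-c : (bit tB ⊕ B.g) c ≡ false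
    B-at-c = trans (bit-other-⊕ tB B.g (c≢tB tagB)) (B.outside c (inj₁ a+wA<b))

  adjacent-inner : a + wA ≡ b → b + wB < n → tB ≡ b + wB → ⊥
  adjacent-inner a+wA≡b b+wB<n tB≡ = differ-at b+wB<n λ eq → true≢false (sym (trans (sym A-at-c) (trans eq B-at-c)))
    where
    c = b + wB
    b<c : b < c
    b<c = subst (_≤ b + wB) (+-comm b 1) (+-monoʳ-≤ b 1≤wB)
    A-at-c : (bit tA ⊕ A.g) c ≡ false
    A-at-c = trans (bit-other-⊕ tA A.g (λ c≡tA → <-irrefl (sym (trans c≡tA (trans tA≡ a+wA≡b))) b<c))
                   (A.outside c (inj₂ (≤-trans (≤-reflexive a+wA≡b) (m≤m+n b wB))))
    B-at-c : (bit tB ⊕ B.g) c ≡ true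
    B-at-c = trans (⊕-false (bit tB) B.g (B.outside c (inj₂ ≤-refl))) (trans (cong (λ t → bit t c) tB≡) (bit-self c))

  adjacent-last : a + wA ≡ b → tB ≡ 0 → 1 ≤ a → ⊥
  adjacent-last a+wA≡b tB≡0 1≤a =
    differ-at (≤-trans (s≤s z≤n) b<n) λ eq → true≢false (sym (trans (sym A-at-0) (trans eq B-at-0)))
    where
    A-at-0 : (bit tA ⊕ A.g) 0 ≡ false
    A-at-0 = trans (bit-other-⊕ tA A.g (λ 0≡tA → <-irrefl (trans 0≡tA tA≡) 1≤a+wA)) (A.outside 0 (inj₁ 1≤a))
    B-at-0 : (bit tB ⊕ B.g) 0 ≡ true
    B-at-0 = trans (⊕-false (bit tB) B.g (B.outside 0 (inj₁ (subst (0 <_) a+wA≡b 1≤a+wA)))) (cong (λ t → bit t 0) tB≡0)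

  -- B's tag 0 is then A's first coordinate, so A's label must be told apart inside A's block.
  adjacent-last-first-wide : a + wA ≡ b → tB ≡ 0 → a ≡ 0 → 2 ≤ wA → ⊥
  adjacent-last-first-wide a+wA≡b tB≡0 a≡0 2≤wA with A.not-first 2≤wA
  ... | c , a≤c , c<a+wA , gc≢ = differ-at (≤-trans c<a+wA (≤-trans a+wA≤b (≤-trans (m≤m+n b wB) b+wB≤n)))
    λ eq → gc≢ (begin
      A.g c                  ≡⟨ bit-other-⊕ tA A.g (λ c≡tA → <-irrefl (trans c≡tA tA≡) c<a+wA) ⟨
      (bit tA ⊕ A.g) c       ≡⟨ eq ⟩
      (bit tB ⊕ B.g) c       ≡⟨ ⊕-false (bit tB) B.g (B.outside c (inj₁ (subst (c <_) a+wA≡b c<a+wA))) ⟩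
      bit tB c               ≡⟨ cong (λ t → bit t c) (trans tB≡0 (sym a≡0)) ⟩
      bit a c                ∎)
    where open ≡-Reasoning

  adjacent-last-wide : a + wA ≡ b → tB ≡ 0 → 2 ≤ wB → ⊥
  adjacent-last-wide a+wA≡b tB≡0 2≤wB with B.not-first 2≤wB
  ... | c , b≤c , c<b+wB , gc≢ = differ-at (≤-trans c<b+wB b+wB≤n)
    λ eq → gc≢ (begin
      B.g c                  ≡⟨ bit-other-⊕ tB B.g (λ c≡tB → <-irrefl (sym (trans c≡tB tB≡0)) (≤-trans (subst (1 ≤_) a+wA≡b 1≤a+wA) b≤c)) ⟨
      (bit tB ⊕ B.g) c       ≡⟨ eq ⟨
      (bit tA ⊕ A.g) c       ≡⟨ ⊕-false (bit tA) A.g (A.outside c (inj₂ (≤-trans (≤-reflexive a+wA≡b) b≤c))) ⟩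
      bit tA c               ≡⟨ cong (λ t → bit t c) (trans tA≡ a+wA≡b) ⟩
      bit b c                ∎)
    where open ≡-Reasoning

  separated : TagOf n b wB tB → ⊥
  separated tagB with a + wA <? b
  ... | yes a+wA<b = gap tagB a+wA<b
  ... | no a+wA≮b with ≤-antisym a+wA≤b (≮⇒≥ a+wA≮b) | tagB
  ...   | a+wA≡b | inj₁ (b+wB<n , tB≡) = adjacent-inner a+wA≡b b+wB<n tB≡
  ...   | a+wA≡b | inj₂ (b+wB≡n , tB≡0) with 1 ≤? a | 2 ≤? wA | 2 ≤? wB
  ...     | yes 1≤a | _ | _ = adjacent-last a+wA≡b tB≡0 1≤a
  ...     | no 1≰a | yes 2≤wA | _ = adjacent-last-first-wide a+wA≡b tB≡0 (n<1⇒n≡0 (≰⇒> 1≰a)) 2≤wA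
  ...     | no _ | no _ | yes 2≤wB = adjacent-last-wide a+wA≡b tB≡0 2≤wB
  ...     | no 1≰a | no 2≰wA | no 2≰wB = <-irrefl refl (≤-trans (s≤s (≤-trans 5≤n (≤-reflexive (sym b+wB≡n)))) b+wB<5)
    where
    b+wB<5 : b + wB < 5
    b+wB<5 = ≤-trans (s≤s (+-mono-≤ (≤-trans (≤-reflexive (sym a+wA≡b)) (+-mono-≤ (≤-pred (≰⇒> 1≰a)) (≤-pred (≰⇒> 2≰wA))))
                                    (≤-pred (≰⇒> 2≰wB))))
                     (from-yes (3 ≤? 5))

labels-separated : ∀ {n a wA b wB tA tB} → 5 ≤ n → 1 ≤ wA → 1 ≤ wB → a + wA ≤ b → b + wB ≤ n →
                   tA ≡ a + wA → TagOf n b wB tB →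
                   ∀ {ℓA ℓB : Config n} → Tagged a wA tA ℓA → Tagged b wB tB ℓB → ℓA ≢ ℓB
labels-separated 5≤n 1≤wA 1≤wB a+wA≤b b+wB≤n tA≡ tagB TA TB ℓA≡ℓB =
  Separation.separated 5≤n 1≤wA 1≤wB a+wA≤b b+wB≤n tA≡ TA TB ℓA≡ℓB tagB

module Classes {n : ℕ} (f : BN n) where
  private
    C : Set
    C = Config n

  record Class : Set where
    field
      out m₀ : C
      ms : List C
      f-members : All (λ x → f x ≡ out) (m₀ ∷ ms)
      members! : Unique (m₀ ∷ ms)
    members : List C
    members = m₀ ∷ ms
    size : ℕ
    size = length members

  totalSize : List Class → ℕ
  totalSize [] = 0
  totalSize (K ∷ Ks) = Class.size K + totalSize Ks

  OutsDistinct : List Class → Set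
  OutsDistinct = AllPairs (λ K K′ → Class.out K ≢ Class.out K′)

  record Partition (L : List C) : Set where
    field
      classes : List Class
      outs-distinct : OutsDistinct classes
      classify : ∀ {a} → a ∈ L → Σ Class λ K → K ∈ classes × f a ≡ Class.out K
      total : totalSize classes ≡ length L
      members⊆ : All (λ K → ∀ {x} → x ∈ Class.members K → x ∈ L) classes

  partition : ∀ k (L : List C) → length L ≤ k → Unique L → Partition L
  partition k [] _ _ = record { classes = [] ; outs-distinct = [] ; classify = λ () ; total = refl ; members⊆ = [] }
  partition (suc k) (a ∷ L) (s≤s |L|≤k) (a∉L ∷ L!) = record
    { classes = K ∷ R.classes
    ; outs-distinct = All.tabulate (λ K′∈ fa≡out → other-out K′∈ (sym fa≡out)) ∷ R.outs-distinct
    ; classify = classify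
    ; total = cong suc (trans (cong (length same +_) R.total) (length-filter-∁ (same? a) L))
    ; members⊆ = members⊆K ∷ All.map (λ m⊆ {x} x∈ → there (in-L-of-different (m⊆ x∈))) R.members⊆ }
    where
    same? : ∀ b → Decidable₁ (λ x → f x ≡ f b)
    same? b x = f x ≟ᶜ f b
    same different : List C
    same = filter (same? a) L
    different = filter (∁? (same? a)) L
    in-L-of-different : ∀ {x} → x ∈ different → x ∈ L
    in-L-of-different x∈ = proj₁ (∈-filter⁻ (∁? (same? a)) {xs = L} x∈)
    K : Class
    K = record
      { out = f a ; m₀ = a ; ms = same
      ; f-members = refl ∷ All.all-filter (same? a) L
      ; members! = All.tabulate (λ x∈ → All.lookup a∉L (proj₁ (∈-filter⁻ (same? a) {xs = L} x∈)))
                   ∷ Unique.filter⁺ (same? a) L! }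
    members⊆K : ∀ {x} → x ∈ Class.members K → x ∈ a ∷ L
    members⊆K (here x≡a) = here x≡a
    members⊆K (there x∈) = there (proj₁ (∈-filter⁻ (same? a) {xs = L} x∈))
    R : Partition different
    R = partition k different (≤-trans (length-filter (∁? (same? a)) L) |L|≤k) (Unique.filter⁺ (∁? (same? a)) L!)
    module R = Partition R
    other-out : ∀ {K′} → K′ ∈ R.classes → Class.out K′ ≢ f a
    other-out {K′} K′∈ out≡fa = proj₂ (∈-filter⁻ (∁? (same? a)) {xs = L} (All.lookup R.members⊆ K′∈ (here refl)))
                                 (trans (All.head (Class.f-members K′)) out≡fa)
    classify : ∀ {b} → b ∈ a ∷ L → Σ Class λ K′ → K′ ∈ K ∷ R.classes × f b ≡ Class.out K′
    classify (here refl) = K , here refl , refl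
    classify {b} (there b∈L) with same? a b
    ... | yes fb≡fa = K , here refl , fb≡fa
    ... | no fb≢fa = let (K′ , K′∈ , fb≡) = R.classify (∈-filter⁺ (∁? (same? a)) b∈L fb≢fa) in K′ , there K′∈ , fb≡

even-count-bound : ∀ {c P n} → c + P ≡ 2 * n → P ≤ c → n ≤ c
even-count-bound {c} {P} {n} c+P≡2n P≤c = *-cancelˡ-≤ 2 (begin
  2 * n        ≡⟨ c+P≡2n ⟨
  c + P        ≤⟨ +-monoʳ-≤ c P≤c ⟩
  c + c        ≡⟨ cong (c +_) (+-identityʳ c) ⟨
  2 * c        ∎)
  where open ≤-Reasoning

1+n≤2n : ∀ {n} → 1 ≤ n → suc n ≤ 2 * n
1+n≤2n {n} 1≤n = subst (_≤ 2 * n) (+-comm n 1) (+-monoʳ-≤ n (≤-trans 1≤n (m≤m+n n 0)))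

halve-odd : ∀ a b → 2 * a ≤ suc (2 * b) → a ≤ b
halve-odd a b 2a≤1+2b with a ≤? b
... | yes a≤b = a≤b
... | no a≰b = ⊥-elim (1+n≰n (≤-pred (begin
  2 + 2 * b    ≡⟨ *-suc 2 b ⟨
  2 * suc b    ≤⟨ *-monoʳ-≤ 2 (≰⇒> a≰b) ⟩
  2 * a        ≤⟨ 2a≤1+2b ⟩
  1 + 2 * b    ∎)))
  where open ≤-Reasoning

odd-count-bound : ∀ {n s T P} → 1 ≤ s → 1 ≤ P → 2 * n ≡ s + T → 2 * P * s ≤ T → n + P ≤ T
odd-count-bound {n} {suc s} {T} {suc P} _ _ 2n≡s+T 2Ps≤T = halve-odd (n + P′) T (begin
  2 * (n + P′)              ≡⟨ *-distribˡ-+ 2 n P′ ⟩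
  2 * n + 2 * P′            ≡⟨ cong (_+ 2 * P′) 2n≡s+T ⟩
  suc s + T + 2 * P′        ≡⟨ +-comm (suc s + T) (2 * P′) ⟩
  2 * P′ + (suc s + T)      ≡⟨ +-assoc (2 * P′) (suc s) T ⟨
  2 * P′ + suc s + T        ≡⟨ +-comm (2 * P′ + suc s) T ⟩
  T + (2 * P′ + suc s)      ≤⟨ +-monoʳ-≤ T key ⟩
  T + suc (2 * P′ * suc s)  ≤⟨ +-monoʳ-≤ T (s≤s 2Ps≤T) ⟩
  T + suc T                 ≡⟨ +-suc T T ⟩
  suc (T + T)               ≡⟨ cong (λ t → suc (T + t)) (+-identityʳ T) ⟨
  suc (2 * T)               ∎)
  where
  open ≤-Reasoning
  open +-*-Solver
  P′ : ℕ
  P′ = suc P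
  -- (2P − 1)(s − 1) ≥ 0
  key : 2 * P′ + suc s ≤ suc (2 * P′ * suc s)
  key = ≤-trans (m≤m+n (2 * P′ + suc s) (s + 2 * P * s)) (≤-reflexive
    (solve 2 (λ s P → (con 2 :* (con 1 :+ P) :+ (con 1 :+ s)) :+ (s :+ con 2 :* P :* s)
                      := con 1 :+ con 2 :* (con 1 :+ P) :* (con 1 :+ s)) refl s P))

module Forests {n : ℕ} (f : BN n) where
  private
    C : Set
    C = Config n

  record ClassPair : Set where
    field
      c d x₀ y₀ : C
      xs ys : List C
      f-xs : All (λ x → f x ≡ c) (x₀ ∷ xs)
      f-ys : All (λ y → f y ≡ d) (y₀ ∷ ys)
      fewer-xs : length xs ≤ length ys
    Y : List C
    Y = y₀ ∷ ys
    coverage : ℕ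
    coverage = length Y + length xs
    points outputs : List C
    points = x₀ ∷ (Y ++ xs)
    outputs = c ∷ d ∷ []

  record Tree : Set where
    field
      c d x₀ : C
      ys xs : List C
      o tg : ℕ
      ext : Bits
      f-xs : All (λ x → f x ≡ c) (x₀ ∷ xs)
      f-ys : All (λ y → f y ≡ d) ys
    open Caterpillar o tg ext x₀ ys xs public
    field
      fits : o + w ≤ n
      1≤|ys| : 1 ≤ length ys
      shape : ExtShape o (length ys) w ext
      tag : TagOf n o w tg
    end : ℕ
    end = o + w
    points outputs : List C
    points = x₀ ∷ (ys ++ xs)
    outputs = c ∷ d ∷ []

  module Prefix (cp : ClassPair) (o tg k l : ℕ) (k≤|Y| : k ≤ length (ClassPair.Y cp)) (l≤|xs| : l ≤ length (ClassPair.xs cp))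
           (1≤k : 1 ≤ k) (narrow-or-long : k + l ≤ 1 ⊎ 2 ≤ k) (fits : o + (k + l) ≤ n) (tag : TagOf n o (k + l) tg) where
    open ClassPair cp

    private
      |ys|≡k : length (take k Y) ≡ k
      |ys|≡k = length-take-≤ k≤|Y|
      w≡k+l : length (take k Y) + length (take l xs) ≡ k + l
      w≡k+l = cong₂ _+_ |ys|≡k (length-take-≤ l≤|xs|)
      shaped : Σ Bits (ExtShape o (length (take k Y)) (length (take k Y) + length (take l xs)))
      shaped = extShape o (length (take k Y)) (length (take k Y) + length (take l xs))
                 (Data.Sum.map (≤-trans (≤-reflexive w≡k+l)) (subst (2 ≤_) (sym |ys|≡k)) narrow-or-long)

    prefixTree : Tree
    prefixTree = record
      { c = c ; d = d ; x₀ = x₀ ; ys = take k Y ; xs = take l xs ; o = o ; tg = tg ; ext = proj₁ shaped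
      ; f-xs = All.take⁺ (suc l) f-xs ; f-ys = All.take⁺ k f-ys
      ; fits = subst (λ w → o + w ≤ n) (sym w≡k+l) fits ; 1≤|ys| = subst (1 ≤_) (sym |ys|≡k) 1≤k
      ; shape = proj₂ shaped ; tag = subst (λ w → TagOf n o w tg) (sym w≡k+l) tag }

    prefixTree-end : Tree.end prefixTree ≡ o + (k + l)
    prefixTree-end = cong (o +_) w≡k+l

    prefixTree-points : Tree.points prefixTree ⊆ points
    prefixTree-points = refl ∷ Sublist.++⁺ (Sublist.take-⊆ k Y) (Sublist.take-⊆ l xs)

  record Planted (o : ℕ) (cp : ClassPair) : Set where
    field
      tree : Tree
      starts-at : Tree.o tree ≡ o
      points⊆ : Tree.points tree ⊆ ClassPair.points cp
      outputs≡ : Tree.outputs tree ≡ ClassPair.outputs cp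
      reach : Tree.end tree ≡ n ⊎ (Tree.end tree ≡ o + ClassPair.coverage cp × Tree.end tree < n)

  module _ {o : ℕ} (o<n : o < n) (cp : ClassPair) where
    open ClassPair cp
    private
      r : ℕ
      r = n ∸ o
      o+r≡n : o + r ≡ n
      o+r≡n = m+[n∸m]≡n (<⇒≤ o<n)

    plant-ending-in-ys : r ≤ length Y → Planted o cp
    plant-ending-in-ys r≤|Y| = record
      { tree = prefixTree ; starts-at = refl ; points⊆ = prefixTree-points ; outputs≡ = refl
      ; reach = inj₁ (trans prefixTree-end o+r+0≡n) }
      where
      o+r+0≡n : o + (r + 0) ≡ n
      o+r+0≡n = trans (cong (o +_) (+-identityʳ r)) o+r≡n
      narrow-or-long : r + 0 ≤ 1 ⊎ 2 ≤ r
      narrow-or-long with 2 ≤? r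
      ... | yes 2≤r = inj₂ 2≤r
      ... | no 2≰r = inj₁ (≤-trans (≤-reflexive (+-identityʳ r)) (≤-pred (≰⇒> 2≰r)))
      open Prefix cp o 0 r 0 r≤|Y| z≤n (m<n⇒0<n∸m o<n) narrow-or-long (≤-reflexive o+r+0≡n) (inj₂ (o+r+0≡n , refl))

    plant-ending-in-xs : length Y < r → r ≤ coverage → Planted o cp
    plant-ending-in-xs |Y|<r r≤cov = record
      { tree = prefixTree ; starts-at = refl ; points⊆ = prefixTree-points ; outputs≡ = refl
      ; reach = inj₁ (trans prefixTree-end o+|Y|+l≡n) }
      where
      l : ℕ
      l = r ∸ length Y
      |Y|+l≡r : length Y + l ≡ r
      |Y|+l≡r = m+[n∸m]≡n (<⇒≤ |Y|<r)
      o+|Y|+l≡n : o + (length Y + l) ≡ n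
      o+|Y|+l≡n = trans (cong (o +_) |Y|+l≡r) o+r≡n
      l≤|xs| : l ≤ length xs
      l≤|xs| = +-cancelˡ-≤ (length Y) l (length xs) (≤-trans (≤-reflexive |Y|+l≡r) r≤cov)
      2≤|Y| : 2 ≤ length Y
      2≤|Y| = s≤s (≤-trans (≤-trans (m<n⇒0<n∸m |Y|<r) l≤|xs|) fewer-xs)
      open Prefix cp o 0 (length Y) l ≤-refl l≤|xs| (s≤s z≤n) (inj₂ 2≤|Y|) (≤-reflexive o+|Y|+l≡n) (inj₂ (o+|Y|+l≡n , refl))

    plant-whole : coverage < r → Planted o cp
    plant-whole cov<r = record
      { tree = prefixTree ; starts-at = refl ; points⊆ = prefixTree-points ; outputs≡ = refl
      ; reach = inj₂ (prefixTree-end , subst (_< n) (sym prefixTree-end) o+cov<n) }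
      where
      o+cov<n : o + coverage < n
      o+cov<n = subst (o + coverage <_) o+r≡n (+-monoʳ-< o cov<r)
      narrow-or-long : coverage ≤ 1 ⊎ 2 ≤ length Y
      narrow-or-long with ys | fewer-xs
      ... | [] | |xs|≤0 = inj₁ (s≤s |xs|≤0)
      ... | _ ∷ _ | _ = inj₂ (s≤s (s≤s z≤n))
      open Prefix cp o (o + coverage) (length Y) (length xs) ≤-refl ≤-refl (s≤s z≤n) narrow-or-long
                  (<⇒≤ o+cov<n) (inj₁ (o+cov<n , refl))

  plant : ∀ o → o < n → (cp : ClassPair) → Planted o cp
  plant o o<n cp with n ∸ o ≤? length Y | n ∸ o ≤? coverage
    where open ClassPair cp
  ... | yes r≤|Y| | _ = plant-ending-in-ys o<n cp r≤|Y|
  ... | no r≰|Y| | yes r≤cov = plant-ending-in-xs o<n cp (≰⇒> r≰|Y|) r≤cov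
  ... | no _ | no r≰cov = plant-whole o<n cp (≰⇒> r≰cov)

  totalCoverage : List ClassPair → ℕ
  totalCoverage [] = 0
  totalCoverage (cp ∷ cps) = ClassPair.coverage cp + totalCoverage cps

  record Forest (o : ℕ) (cps : List ClassPair) : Set where
    field
      trees : List Tree
      ordered : AllPairs (λ T T′ → Tree.end T ≤ Tree.o T′) trees
      after : All (λ T → o ≤ Tree.o T) trees
      covers : ∀ j → o ≤ j → j < n → Σ Tree λ T → T ∈ trees × Tree.o T ≤ j × j < Tree.end T
      few : length trees + o ≤ n
      points⊆ : concatMap Tree.points trees ⊆ concatMap ClassPair.points cps
      outputs⊆ : concatMap Tree.outputs trees ⊆ concatMap ClassPair.outputs cps

  o<end : (T : Tree) → Tree.o T < Tree.end T
  o<end T = subst (_≤ o + w) (+-comm o 1) (+-monoʳ-≤ o (≤-trans 1≤|ys| (m≤m+n (length ys) _)))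
    where open Tree T

  grow : ∀ o → o < n → (cps : List ClassPair) → n ≤ o + totalCoverage cps → Forest o cps
  grow o o<n [] n≤o+0 = ⊥-elim (<-irrefl refl (≤-trans o<n (≤-trans n≤o+0 (≤-reflexive (+-identityʳ o)))))
  grow o o<n (cp ∷ cps) n≤o+cov with plant o o<n cp
  ... | record { tree = T ; starts-at = refl ; points⊆ = T⊆cp ; outputs≡ = T-outs ; reach = inj₁ end≡n } = record
    { trees = T ∷ []
    ; ordered = [] ∷ []
    ; after = ≤-refl ∷ []
    ; covers = λ j o≤j j<n → T , here refl , o≤j , subst (j <_) (sym end≡n) j<n
    ; few = subst (suc (Tree.o T) ≤_) end≡n (o<end T)
    ; points⊆ = Sublist.++⁺ T⊆cp (minimum _)
    ; outputs⊆ = Sublist.++⁺ (⊆-reflexive T-outs) (minimum _) }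
  ... | record { tree = T ; starts-at = refl ; points⊆ = T⊆cp ; outputs≡ = T-outs ; reach = inj₂ (end≡ , end<n) } = record
    { trees = T ∷ F.trees
    ; ordered = All.map (≤-trans (≤-reflexive end≡)) F.after ∷ F.ordered
    ; after = ≤-refl ∷ All.map (≤-trans (≤-trans (<⇒≤ (o<end T)) (≤-reflexive end≡))) F.after
    ; covers = covers
    ; few = ≤-trans (≤-reflexive (sym (+-suc (length F.trees) o))) (≤-trans (+-monoʳ-≤ (length F.trees) 1+o≤o′) F.few)
    ; points⊆ = Sublist.++⁺ T⊆cp F.points⊆
    ; outputs⊆ = Sublist.++⁺ (⊆-reflexive T-outs) F.outputs⊆ }
    where
    o′ : ℕ
    o′ = o + ClassPair.coverage cp
    1+o≤o′ : suc o ≤ o′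
    1+o≤o′ = subst (suc o ≤_) end≡ (o<end T)
    F : Forest o′ cps
    F = grow o′ (subst (_< n) end≡ end<n) cps (≤-trans n≤o+cov (≤-reflexive (sym (+-assoc o _ (totalCoverage cps)))))
    module F = Forest F
    covers : ∀ j → o ≤ j → j < n → Σ Tree λ T′ → T′ ∈ T ∷ F.trees × Tree.o T′ ≤ j × j < Tree.end T′
    covers j o≤j j<n with j <? o′
    ... | yes j<o′ = T , here refl , o≤j , subst (j <_) (sym end≡) j<o′
    ... | no j≮o′ = let (T′ , T′∈ , o≤j′ , j<end) = F.covers j (≮⇒≥ j≮o′) j<n in T′ , there T′∈ , o≤j′ , j<end

  outputPairs : List Tree → List C → List (C × C)
  outputPairs (T ∷ ts) (ℓ ∷ ℓs) = (Tree.c T , ℓ) ∷ (Tree.d T , Vec.map not ℓ) ∷ outputPairs ts ℓs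
  outputPairs _ _ = []

  outputPairs-labels : ∀ ts ℓs → length ℓs ≡ length ts → map proj₂ (outputPairs ts ℓs) ≡ withComplements ℓs
  outputPairs-labels [] [] _ = refl
  outputPairs-labels (T ∷ ts) (ℓ ∷ ℓs) eq =
    cong (λ rest → ℓ ∷ Vec.map not ℓ ∷ rest) (outputPairs-labels ts ℓs (suc-injective eq))

  outputPairs-points : ∀ ts ℓs → length ℓs ≡ length ts → map proj₁ (outputPairs ts ℓs) ≡ concatMap Tree.outputs ts
  outputPairs-points [] [] _ = refl
  outputPairs-points (T ∷ ts) (ℓ ∷ ℓs) eq =
    cong (λ rest → Tree.c T ∷ Tree.d T ∷ rest) (outputPairs-points ts ℓs (suc-injective eq))

  outputPair : ∀ ts ℓs → length ℓs ≡ length ts → ∀ {T} → T ∈ ts →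
               Σ C λ ℓ → (Tree.c T , ℓ) ∈ outputPairs ts ℓs × (Tree.d T , Vec.map not ℓ) ∈ outputPairs ts ℓs
  outputPair (T ∷ ts) (ℓ ∷ ℓs) _ (here refl) = ℓ , here refl , there (here refl)
  outputPair (T ∷ ts) (ℓ ∷ ℓs) eq (there T∈ts) =
    let (ℓ′ , c↦ , d↦) = outputPair ts ℓs (suc-injective eq) T∈ts in ℓ′ , there (there c↦) , there (there d↦)

  module Labelling (5≤n : 5 ≤ n) (A : List C) (independent : ∀ x → x ∈ A → f x ∉ A) (|A|≤2n : length A ≤ 2 * n)
                   (cps : List ClassPair) (n≤cov : n ≤ totalCoverage cps)
                   (points! : Unique (concatMap ClassPair.points cps)) (outputs! : Unique (concatMap ClassPair.outputs cps))
                   (points⊆A : ∀ {x} → x ∈ concatMap ClassPair.points cps → x ∈ A) where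
    1≤n : 1 ≤ n
    1≤n = ≤-trans (s≤s z≤n) 5≤n

    open Forest (grow 0 1≤n cps n≤cov)

    treePairs : List (C × C)
    treePairs = concatMap Tree.pairs trees

    treePairs-points : map proj₁ treePairs ≡ concatMap Tree.points trees
    treePairs-points = trans (map-concatMap proj₁ Tree.pairs trees) (concatMap-cong Tree.pairs-points trees)

    treePoints-unique : Unique (concatMap Tree.points trees)
    treePoints-unique = unique-⊆ points⊆ points!

    treePoint∈A : ∀ {T x} → T ∈ trees → x ∈ Tree.points T → x ∈ A
    treePoint∈A T∈ x∈ = points⊆A (Sublist.Any-resp-⊆ points⊆ (∈-concat⁺′ x∈ (∈-map⁺ Tree.points T∈)))

    c∉A : ∀ {T} → T ∈ trees → Tree.c T ∉ A
    c∉A {T} T∈ = independent x₀ (treePoint∈A T∈ (here refl)) ∘ subst (_∈ A) (sym (All.head f-xs))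
      where open Tree T

    d∉A : ∀ {T} → T ∈ trees → Tree.d T ∉ A
    d∉A {T} T∈ = via (Tree.ys T) (Tree.f-ys T) (Tree.1≤|ys| T) (λ y∈ys → treePoint∈A T∈ (there (∈-++⁺ˡ y∈ys)))
      where
      via : ∀ ys → All (λ y → f y ≡ Tree.d T) ys → 1 ≤ length ys → (∀ {y} → y ∈ ys → y ∈ A) → Tree.d T ∉ A
      via (y ∷ _) (fy≡d ∷ _) _ ys⊆A = independent y (ys⊆A (here refl)) ∘ subst (_∈ A) (sym fy≡d)

    output∉A : ∀ {v} → v ∈ concatMap Tree.outputs trees → v ∉ A
    output∉A p with find (∈-concatMap⁻ Tree.outputs {xs = trees} p)
    ... | T , T∈ , here refl = c∉A T∈
    ... | T , T∈ , there (here refl) = d∉A T∈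

    labelsOf : Tree → List C
    labelsOf = map proj₂ ∘ Tree.pairs

    tagged : ∀ T {v} → v ∈ labelsOf T → Tagged (Tree.o T) (Tree.w T) (Tree.tg T) v
    tagged T = Tree.tagged T (Tree.fits T) (Tree.1≤|ys| T) (Tree.shape T)

    1≤w : ∀ T → 1 ≤ Tree.w T
    1≤w T = ≤-trans (Tree.1≤|ys| T) (m≤m+n (length (Tree.ys T)) _)

    -- A caterpillar followed by another one is not the last, so its tag is its end.
    separated : ∀ {T T′} → Tree.end T ≤ Tree.o T′ → Disjoint (labelsOf T) (labelsOf T′)
    separated {T} {T′} end≤o′ (p , q) =
      labels-separated 5≤n (1≤w T) (1≤w T′) end≤o′ (Tree.fits T′) tag≡end (Tree.tag T′) (tagged T p) (tagged T′ q) refl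
      where
      tag≡end : Tree.tg T ≡ Tree.end T
      tag≡end with Tree.tag T
      ... | inj₁ (_ , tg≡) = tg≡
      ... | inj₂ (end≡n , _) =
        ⊥-elim (<-irrefl refl (≤-trans (o<end T′) (≤-trans (Tree.fits T′) (subst (_≤ Tree.o T′) end≡n end≤o′))))

    U : List C
    U = map proj₂ treePairs

    U-unique : Unique U
    U-unique = subst Unique (sym (map-concatMap proj₂ Tree.pairs trees))
      (Unique.concat⁺ (All.map⁺ (All.tabulate λ {T} _ → Tree.labels-unique T (Tree.fits T) (Tree.1≤|ys| T)))
                      (AllPairs.map⁺ (AllPairs.map (λ {T} {T′} → separated {T} {T′}) ordered)))

    |U|≤2n : length U ≤ 2 * n
    |U|≤2n = begin
      length U                             ≡⟨ length-map proj₂ treePairs ⟩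
      length treePairs                     ≡⟨ sym (length-map proj₁ treePairs) ⟩
      length (map proj₁ treePairs)         ≡⟨ cong length treePairs-points ⟩
      length (concatMap Tree.points trees) ≤⟨ unique-length-≤ treePoints-unique (points⊆A ∘ Sublist.Any-resp-⊆ points⊆) ⟩
      length A                             ≤⟨ |A|≤2n ⟩
      2 * n                                ∎
      where open ≤-Reasoning

    q : ℕ
    q = length trees

    fresh : Σ (List C) λ ℓs → length ℓs ≡ q × Unique (withComplements ℓs) × (∀ {v} → v ∈ withComplements ℓs → v ∉ U)
    fresh = fresh-complementary-labels 1≤n U q
              (≤-trans (+-mono-≤ (≤-trans (≤-reflexive (sym (+-identityʳ q))) few) |U|≤2n) (3n≤2^[n-1] 5≤n))

    ℓs : List C
    ℓs = proj₁ fresh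

    |ℓs|≡q : length ℓs ≡ q
    |ℓs|≡q = proj₁ (proj₂ fresh)

    outPairs allPairs : List (C × C)
    outPairs = outputPairs trees ℓs
    allPairs = treePairs ++ outPairs

    points-unique : Unique (map proj₁ allPairs)
    points-unique = unique-map-++ proj₁ treePairs outPairs
      (subst Unique (sym treePairs-points) treePoints-unique)
      (subst Unique (sym (outputPairs-points trees ℓs |ℓs|≡q)) (unique-⊆ outputs⊆ outputs!))
      λ (p , q) → output∉A (subst (_ ∈_) (outputPairs-points trees ℓs |ℓs|≡q) q)
                           (points⊆A (Sublist.Any-resp-⊆ points⊆ (subst (_ ∈_) treePairs-points p)))

    labels-unique : Unique (map proj₂ allPairs)
    labels-unique = unique-map-++ proj₂ treePairs outPairs U-unique
      (subst Unique (sym (outputPairs-labels trees ℓs |ℓs|≡q)) (proj₁ (proj₂ (proj₂ fresh))))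
      λ (p , q) → proj₂ (proj₂ (proj₂ fresh)) (subst (_ ∈_) (outputPairs-labels trees ℓs |ℓs|≡q) q) p

    edge : ∀ j → LabelledEdge f allPairs j
    edge j with covers (toℕ j) z≤n (toℕ<n j)
    ... | T , T∈ , o≤j , j<end with Tree.edge T (Tree.fits T) (Tree.1≤|ys| T) j o≤j j<end | outputPair trees ℓs |ℓs|≡q T∈
    ...   | e | ℓ , c↦ℓ , d↦¬ℓ = from-ends E.ends
      where
      open Tree T using (f-xs; f-ys)
      module E = Tree.Edge T e
      in-tree : ∀ {p} → p ∈ Tree.pairs T → p ∈ allPairs
      in-tree p = ∈-++⁺ˡ (∈-concat⁺′ p (∈-map⁺ Tree.pairs T∈))
      in-outputs : ∀ {p} → p ∈ outPairs → p ∈ allPairs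
      in-outputs = ∈-++⁺ʳ treePairs
      from-ends : (E.u ≡ Tree.x₀ T × E.v ∈ Tree.ys T) ⊎ (E.u ∈ Tree.ys T × E.v ∈ Tree.xs T) → LabelledEdge f allPairs j
      from-ends (inj₁ (refl , v∈ys)) = record
        { x₁ = E.u ; x₂ = E.v ; y = E.y ; ℓ₁ = ℓ ; ℓ₂ = Vec.map not ℓ
        ; x₁↦y = in-tree E.u↦y ; x₂↦flipped-y = in-tree E.v↦flipped-y
        ; fx₁↦ℓ₁ = in-outputs (subst (λ w → (w , ℓ) ∈ outPairs) (sym (All.head f-xs)) c↦ℓ)
        ; fx₂↦ℓ₂ = in-outputs (subst (λ w → (w , Vec.map not ℓ) ∈ outPairs) (sym (All.lookup f-ys v∈ys)) d↦¬ℓ)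
        ; ℓ₁#ℓ₂ = complementary-sym {u = Vec.map not ℓ} {ℓ} (map-not-complementary ℓ) }
      from-ends (inj₂ (u∈ys , v∈xs)) = record
        { x₁ = E.u ; x₂ = E.v ; y = E.y ; ℓ₁ = Vec.map not ℓ ; ℓ₂ = ℓ
        ; x₁↦y = in-tree E.u↦y ; x₂↦flipped-y = in-tree E.v↦flipped-y
        ; fx₁↦ℓ₁ = in-outputs (subst (λ w → (w , Vec.map not ℓ) ∈ outPairs) (sym (All.lookup f-ys u∈ys)) d↦¬ℓ)
        ; fx₂↦ℓ₂ = in-outputs (subst (λ w → (w , ℓ) ∈ outPairs) (sym (All.lookup f-xs (there v∈xs))) c↦ℓ)
        ; ℓ₁#ℓ₂ = map-not-complementary ℓ }

    complete : CompleteInIsoClass f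
    complete = labelling-complete f allPairs points-unique labels-unique edge

-- Pairing up classes; the smaller class of a pair provides the root and the xs

module Pairing {n : ℕ} (f : BN n) where
  open Classes f
  open Forests f


  oriented : (K K′ : Class) → Class.size K ≤ Class.size K′ → ClassPair
  oriented K K′ K≤K′ = record
    { c = Class.out K ; d = Class.out K′ ; x₀ = Class.m₀ K ; y₀ = Class.m₀ K′ ; xs = Class.ms K ; ys = Class.ms K′
    ; f-xs = Class.f-members K ; f-ys = Class.f-members K′ ; fewer-xs = ≤-pred K≤K′ }

  classPair : Class → Class → ClassPair
  classPair K K′ with Class.size K ≤? Class.size K′
  ... | yes K≤K′ = oriented K K′ K≤K′
  ... | no K≰K′ = oriented K′ K (<⇒≤ (≰⇒> K≰K′))

  data Orientation (K K′ : Class) : ClassPair → Set where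
    as-given : ∀ K≤K′ → Orientation K K′ (oriented K K′ K≤K′)
    swapped : ∀ K′≤K → Orientation K K′ (oriented K′ K K′≤K)

  orientation : ∀ K K′ → Orientation K K′ (classPair K K′)
  orientation K K′ with Class.size K ≤? Class.size K′
  ... | yes K≤K′ = as-given K≤K′
  ... | no K≰K′ = swapped (<⇒≤ (≰⇒> K≰K′))

  module _ (K K′ : Class) where
    open Class

    oriented-coverage : ∀ K≤K′ → suc (ClassPair.coverage (oriented K K′ K≤K′)) ≡ size K + size K′
    oriented-coverage _ = cong suc (+-comm (size K′) (length (ms K)))

    oriented-points : ∀ K≤K′ {x} → x ∈ ClassPair.points (oriented K K′ K≤K′) → x ∈ members K ⊎ x ∈ members K′
    oriented-points _ (here x≡m₀) = inj₁ (here x≡m₀)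
    oriented-points _ (there x∈) = Data.Sum.map there id (Data.Sum.swap (∈-++⁻ (members K′) x∈))

    oriented-points-unique : out K ≢ out K′ → ∀ K≤K′ → Unique (ClassPair.points (oriented K K′ K≤K′))
    oriented-points-unique K≢K′ _ with members! K
    ... | m₀∉ms ∷ ms! = All.tabulate m₀-fresh ∷ Unique.++⁺ (members! K′) ms! apart
      where
      other-image : ∀ {x y} → x ∈ members K → y ∈ members K′ → x ≢ y
      other-image x∈ y∈ refl = K≢K′ (trans (sym (All.lookup (f-members K) x∈)) (All.lookup (f-members K′) y∈))
      m₀-fresh : ∀ {v} → v ∈ members K′ ++ ms K → m₀ K ≢ v
      m₀-fresh v∈ with ∈-++⁻ (members K′) v∈
      ... | inj₁ v∈K′ = other-image (here refl) v∈K′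
      ... | inj₂ v∈ms = All.lookup m₀∉ms v∈ms
      apart : Disjoint (members K′) (ms K)
      apart (y∈ , x∈) = other-image (there x∈) y∈ refl

  classPair-coverage : ∀ K K′ → suc (ClassPair.coverage (classPair K K′)) ≡ Class.size K + Class.size K′
  classPair-coverage K K′ with classPair K K′ | orientation K K′
  ... | _ | as-given K≤K′ = oriented-coverage K K′ K≤K′
  ... | _ | swapped K′≤K = trans (oriented-coverage K′ K K′≤K) (+-comm (Class.size K′) (Class.size K))

  classPair-points : ∀ K K′ {x} → x ∈ ClassPair.points (classPair K K′) → x ∈ Class.members K ⊎ x ∈ Class.members K′
  classPair-points K K′ with classPair K K′ | orientation K K′
  ... | _ | as-given K≤K′ = oriented-points K K′ K≤K′
  ... | _ | swapped K′≤K = Data.Sum.swap ∘ oriented-points K′ K K′≤K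

  classPair-outputs : ∀ K K′ {v} → v ∈ ClassPair.outputs (classPair K K′) → v ≡ Class.out K ⊎ v ≡ Class.out K′
  classPair-outputs K K′ with classPair K K′ | orientation K K′
  ... | _ | as-given K≤K′ = λ { (here v≡) → inj₁ v≡ ; (there (here v≡)) → inj₂ v≡ }
  ... | _ | swapped K′≤K = λ { (here v≡) → inj₂ v≡ ; (there (here v≡)) → inj₁ v≡ }

  classPair-points-unique : ∀ K K′ → Class.out K ≢ Class.out K′ → Unique (ClassPair.points (classPair K K′))
  classPair-points-unique K K′ K≢K′ with classPair K K′ | orientation K K′
  ... | _ | as-given K≤K′ = oriented-points-unique K K′ K≢K′ K≤K′
  ... | _ | swapped K′≤K = oriented-points-unique K′ K (K≢K′ ∘ sym) K′≤K

  classPair-outputs-unique : ∀ K K′ → Class.out K ≢ Class.out K′ → Unique (ClassPair.outputs (classPair K K′))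
  classPair-outputs-unique K K′ K≢K′ with classPair K K′ | orientation K K′
  ... | _ | as-given _ = (K≢K′ ∷ []) ∷ [] ∷ []
  ... | _ | swapped _ = ((K≢K′ ∘ sym) ∷ []) ∷ [] ∷ []

  pairUp : List Class → List ClassPair
  pairUp (K ∷ K′ ∷ Ks) = classPair K K′ ∷ pairUp Ks
  pairUp _ = []

  pairUp-points : ∀ Ks {x} → x ∈ concatMap ClassPair.points (pairUp Ks) → Σ Class λ K → K ∈ Ks × x ∈ Class.members K
  pairUp-points (K ∷ K′ ∷ Ks) x∈ with ∈-++⁻ (ClassPair.points (classPair K K′)) x∈
  ... | inj₁ x∈cp = Data.Sum.[ (λ x∈K → K , here refl , x∈K) , (λ x∈K′ → K′ , there (here refl) , x∈K′) ]
                                (classPair-points K K′ x∈cp)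
  ... | inj₂ x∈rest = let (K″ , K″∈ , x∈K″) = pairUp-points Ks x∈rest in K″ , there (there K″∈) , x∈K″

  pairUp-outputs : ∀ Ks {v} → v ∈ concatMap ClassPair.outputs (pairUp Ks) → Σ Class λ K → K ∈ Ks × v ≡ Class.out K
  pairUp-outputs (K ∷ K′ ∷ Ks) v∈ with ∈-++⁻ (ClassPair.outputs (classPair K K′)) v∈
  ... | inj₁ v∈cp = Data.Sum.[ (λ v≡ → K , here refl , v≡) , (λ v≡ → K′ , there (here refl) , v≡) ]
                                (classPair-outputs K K′ v∈cp)
  ... | inj₂ v∈rest = let (K″ , K″∈ , v≡) = pairUp-outputs Ks v∈rest in K″ , there (there K″∈) , v≡

  module _ {K K′ : Class} {Ks : List Class} (distinct : OutsDistinct (K ∷ K′ ∷ Ks)) where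
    private
      out-elsewhere : ∀ {v K″} → v ≡ Class.out K ⊎ v ≡ Class.out K′ → K″ ∈ Ks → v ≢ Class.out K″
      out-elsewhere {K″ = K″} (inj₁ refl) K″∈ = All.lookup (AllPairs.head distinct) (there K″∈)
      out-elsewhere {K″ = K″} (inj₂ refl) K″∈ = All.lookup (AllPairs.head (AllPairs.tail distinct)) K″∈

    first-pair-outputs-apart : Disjoint (ClassPair.outputs (classPair K K′)) (concatMap ClassPair.outputs (pairUp Ks))
    first-pair-outputs-apart (v∈ , v∈rest) =
      let (K″ , K″∈ , v≡) = pairUp-outputs Ks v∈rest in out-elsewhere (classPair-outputs K K′ v∈) K″∈ v≡

    first-pair-points-apart : Disjoint (ClassPair.points (classPair K K′)) (concatMap ClassPair.points (pairUp Ks))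
    first-pair-points-apart (x∈ , x∈rest) =
      let (K″ , K″∈ , x∈K″) = pairUp-points Ks x∈rest in
      out-elsewhere (Data.Sum.map (image K) (image K′) (classPair-points K K′ x∈)) K″∈ (image K″ x∈K″)
      where
      image : ∀ K₀ {x} → x ∈ Class.members K₀ → f x ≡ Class.out K₀
      image K₀ = All.lookup (Class.f-members K₀)

  pairUp-points-unique : ∀ Ks → OutsDistinct Ks → Unique (concatMap ClassPair.points (pairUp Ks))
  pairUp-points-unique [] _ = []
  pairUp-points-unique (_ ∷ []) _ = []
  pairUp-points-unique (K ∷ K′ ∷ Ks) distinct@((K≢K′ ∷ _) ∷ (_ ∷ Ks!)) =
    Unique.++⁺ (classPair-points-unique K K′ K≢K′) (pairUp-points-unique Ks Ks!) (first-pair-points-apart distinct)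

  pairUp-outputs-unique : ∀ Ks → OutsDistinct Ks → Unique (concatMap ClassPair.outputs (pairUp Ks))
  pairUp-outputs-unique [] _ = []
  pairUp-outputs-unique (_ ∷ []) _ = []
  pairUp-outputs-unique (K ∷ K′ ∷ Ks) distinct@((K≢K′ ∷ _) ∷ (_ ∷ Ks!)) =
    Unique.++⁺ (classPair-outputs-unique K K′ K≢K′) (pairUp-outputs-unique Ks Ks!) (first-pair-outputs-apart distinct)

  pairUp-parity : ∀ Ks → length Ks ≡ 2 * length (pairUp Ks) ⊎ length Ks ≡ suc (2 * length (pairUp Ks))
  pairUp-parity [] = inj₁ refl
  pairUp-parity (_ ∷ []) = inj₂ refl
  pairUp-parity (K ∷ K′ ∷ Ks) = Data.Sum.map (λ eq → trans (cong (2 +_) eq) (sym (*-suc 2 _)))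
                                              (λ eq → trans (cong (2 +_) eq) (cong suc (sym (*-suc 2 _))))
                                              (pairUp-parity Ks)

  pairUp-coverage : ∀ Ks → length Ks ≡ 2 * length (pairUp Ks) →
                    totalCoverage (pairUp Ks) + length (pairUp Ks) ≡ totalSize Ks
  pairUp-coverage [] _ = refl
  pairUp-coverage (K ∷ K′ ∷ Ks) even = begin
    cov + totalCoverage (pairUp Ks) + suc P  ≡⟨ +-suc (cov + totalCoverage (pairUp Ks)) P ⟩
    suc (cov + totalCoverage (pairUp Ks) + P) ≡⟨ cong suc (+-assoc cov _ P) ⟩
    suc cov + (totalCoverage (pairUp Ks) + P) ≡⟨ cong₂ _+_ (classPair-coverage K K′) (pairUp-coverage Ks Ks-even) ⟩
    (Class.size K + Class.size K′) + totalSize Ks ≡⟨ +-assoc (Class.size K) _ _ ⟩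
    totalSize (K ∷ K′ ∷ Ks) ∎
    where
    open ≡-Reasoning
    cov P : ℕ
    cov = ClassPair.coverage (classPair K K′)
    P = length (pairUp Ks)
    Ks-even : length Ks ≡ 2 * P
    Ks-even = suc-injective (suc-injective (trans even (*-suc 2 P)))

  pairs≤coverage : ∀ cps → length cps ≤ totalCoverage cps
  pairs≤coverage [] = z≤n
  pairs≤coverage (cp ∷ cps) = +-mono-≤ (s≤s z≤n) (pairs≤coverage cps)

  record WithoutSmallest (Ks : List Class) : Set where
    field
      smallest : Class
      rest : List Class
      rest⊆ : rest ⊆ Ks
      total≡ : totalSize Ks ≡ Class.size smallest + totalSize rest
      length≡ : length Ks ≡ suc (length rest)
      minimal : All (λ K → Class.size smallest ≤ Class.size K) rest

  totalSize-remove : ∀ Ks {M} (M∈ : M ∈ Ks) → totalSize Ks ≡ Class.size M + totalSize (remove Ks M∈)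
  totalSize-remove (K ∷ Ks) (here refl) = refl
  totalSize-remove (K ∷ Ks) {M} (there M∈) = begin
    Class.size K + totalSize Ks                                ≡⟨ cong (Class.size K +_) (totalSize-remove Ks M∈) ⟩
    Class.size K + (Class.size M + totalSize (remove Ks M∈))   ≡⟨ +-assoc (Class.size K) _ _ ⟨
    Class.size K + Class.size M + totalSize (remove Ks M∈)     ≡⟨ cong (_+ totalSize (remove Ks M∈)) (+-comm (Class.size K) _) ⟩
    Class.size M + Class.size K + totalSize (remove Ks M∈)     ≡⟨ +-assoc (Class.size M) _ _ ⟩
    Class.size M + (Class.size K + totalSize (remove Ks M∈))   ∎
    where open ≡-Reasoning

  withoutSmallest : ∀ K Ks → WithoutSmallest (K ∷ Ks)
  withoutSmallest K Ks = record
    { smallest = M ; rest = remove (K ∷ Ks) M∈ ; rest⊆ = remove-⊆ (K ∷ Ks) M∈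
    ; total≡ = totalSize-remove (K ∷ Ks) M∈ ; length≡ = sym (length-remove (K ∷ Ks) M∈)
    ; minimal = All-resp-⊆ (remove-⊆ (K ∷ Ks) M∈)
                           (f[argmin]≤f[⊤] {f = Class.size} K Ks ∷ f[argmin]≤f[xs] {f = Class.size} K Ks) }
    where
    M : Class
    M = argmin Class.size K Ks
    M∈ : M ∈ K ∷ Ks
    M∈ with argmin-sel Class.size K Ks
    ... | inj₁ M≡K = here M≡K
    ... | inj₂ M∈Ks = there M∈Ks

  length*≤totalSize : ∀ {s} Ks → All (λ K → s ≤ Class.size K) Ks → length Ks * s ≤ totalSize Ks
  length*≤totalSize [] [] = z≤n
  length*≤totalSize (K ∷ Ks) (s≤K ∷ s≤Ks) = +-mono-≤ s≤K (length*≤totalSize Ks s≤Ks)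

  paired-cover : ∀ Ks → 2 ≤ length Ks → totalSize Ks ≡ 2 * n →
                 Σ (List Class) λ Ls → Ls ⊆ Ks × n ≤ totalCoverage (pairUp Ls)
  paired-cover Ks _ total with pairUp-parity Ks
  ... | inj₁ even = Ks , ⊆-refl , even-count-bound (trans (pairUp-coverage Ks even) total) (pairs≤coverage (pairUp Ks))
  paired-cover (K ∷ Ks) 2≤|Ks| total | inj₂ odd with withoutSmallest K Ks
  ... | record { smallest = M ; rest = rest ; rest⊆ = rest⊆ ; total≡ = total≡ ; length≡ = length≡ ; minimal = minimal }
    with pairUp-parity rest
  ...   | inj₂ rest-odd = ⊥-elim (even≢odd (suc (length (pairUp rest))) (length (pairUp (K ∷ Ks)))
                            (trans (*-suc 2 _) (trans (cong suc (sym rest-odd)) (trans (sym length≡) odd))))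
  ...   | inj₁ rest-even = rest , rest⊆ , +-cancelʳ-≤ P n (totalCoverage (pairUp rest))
                             (≤-trans (odd-count-bound (s≤s z≤n) 1≤P (trans (sym total) total≡) 2Ps≤T)
                                      (≤-reflexive (sym (pairUp-coverage rest rest-even))))
    where
    P : ℕ
    P = length (pairUp rest)
    1≤P : 1 ≤ P
    1≤P = positive P rest-even
      where
      positive : ∀ p → length rest ≡ 2 * p → 1 ≤ p
      positive zero |rest|≡0 = ⊥-elim (<-irrefl refl (≤-trans 2≤|Ks| (≤-reflexive (trans length≡ (cong suc |rest|≡0)))))
      positive (suc _) _ = s≤s z≤n
    2Ps≤T : 2 * P * Class.size M ≤ totalSize rest
    2Ps≤T = subst (λ l → l * Class.size M ≤ totalSize rest) rest-even (length*≤totalSize rest minimal)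

  paired-classes-complete : 5 ≤ n → (A : List (Config n)) → (∀ x → x ∈ A → f x ∉ A) → length A ≡ 2 * n →
                            (Ks : List Class) → OutsDistinct Ks → 2 ≤ length Ks → totalSize Ks ≡ 2 * n →
                            All (λ K → ∀ {x} → x ∈ Class.members K → x ∈ A) Ks → CompleteInIsoClass f
  paired-classes-complete 5≤n A independent |A|≡2n Ks distinct 2≤|Ks| total members⊆ with paired-cover Ks 2≤|Ks| total
  ... | Ls , Ls⊆Ks , n≤cov =
    Labelling.complete 5≤n A independent (≤-reflexive |A|≡2n) (pairUp Ls) n≤cov
                       (pairUp-points-unique Ls Ls-distinct) (pairUp-outputs-unique Ls Ls-distinct) points⊆A
    where
    Ls-distinct : OutsDistinct Ls
    Ls-distinct = allPairs-⊆ Ls⊆Ks distinct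
    points⊆A : ∀ {x} → x ∈ concatMap ClassPair.points (pairUp Ls) → x ∈ A
    points⊆A x∈ = let (K , K∈ , x∈K) = pairUp-points Ls x∈ in All.lookup members⊆ (Sublist.Any-resp-⊆ Ls⊆Ks K∈) x∈K

independent-of-size : ∀ {n} {f : BN n} {k A} → IsIndependent f A → k ≤ length A →
                      Σ (List (Config n)) λ A′ → IsIndependent f A′ × length A′ ≡ k
independent-of-size {k = k} {A} (A! , independent) k≤|A| =
  take k A , (Unique.take⁺ k A! , λ x x∈ fx∈ → independent x (∈-take⁻ k A x∈) (∈-take⁻ k A fx∈)) , length-take-≤ k≤|A|

escape : ∀ {n} (f : BN n) → NonConstant f → ∀ c → Σ (Config n) λ z → f z ≢ c
escape f (x , y , fx≢fy) c with f x ≟ᶜ c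
... | yes fx≡c = y , λ fy≡c → fx≢fy (trans fx≡c (sym fy≡c))
... | no fx≢c = x , fx≢c

lemma3 : (n : ℕ) → 5 ≤ n → (f : BN n) → NonConstant f →
         HasIndepSetOfSize≥ f (2 * n) → CompleteInIsoClass f
lemma3 n 5≤n f nonconstant (A , A-independent , 2n≤|A|) with independent-of-size A-independent 2n≤|A|
... | A′ , (A′! , A′-independent) , |A′|≡2n = from-partition (partition (length A′) A′ ≤-refl A′!)
  where
  open Classes f
  1+n≤|A′| : suc n ≤ length A′
  1+n≤|A′| = subst (suc n ≤_) (sym |A′|≡2n) (1+n≤2n (≤-trans (s≤s z≤n) 5≤n))
  from-partition : Partition A′ → CompleteInIsoClass f
  from-partition record { classes = [] ; total = 0≡|A′| } = ⊥-elim (<-irrefl 0≡|A′| (≤-trans (s≤s z≤n) 1+n≤|A′|))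
  from-partition record { classes = K ∷ [] ; classify = classify } =
    SingleClass.complete 5≤n f A′ A′! A′-independent 1+n≤|A′| (Class.out K) image (proj₁ z) (proj₂ z)
    where
    image : ∀ {a} → a ∈ A′ → f a ≡ Class.out K
    image a∈ with classify a∈
    ... | _ , here refl , fa≡ = fa≡
    z : Σ (Config n) λ z → f z ≢ Class.out K
    z = escape f nonconstant (Class.out K)
  from-partition record { classes = Ks@(_ ∷ _ ∷ _) ; outs-distinct = distinct ; total = total ; members⊆ = members⊆ } =
    Pairing.paired-classes-complete f 5≤n A′ A′-independent |A′|≡2n Ks distinct (s≤s (s≤s z≤n)) (trans total |A′|≡2n) members⊆
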